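{- Let $p$ be an odd prime and let $k$ be an integer with $1<k\le\frac{p-1}{2}$. Then $$\sum_{\substack{x=1\\ x\text{ odd}}}^{p-1}x^{2k-1}\equiv\frac1{2^{2k}}\sum_{m=0}^{2k-2}(-1)^mE(2k-1,m)\pmod{p^2},$$ where $E(n,m)$ is the Eulerian number.
   Context: $E(n,m)$ denotes the number of permutations of $\{1,\dots,n\}$ with exactly $m$ ascents, where for a permutation $(i_1,\dots,i_n)$ an ascent is an index $j$ with $i_{j+1}>i_j$. Congruences are taken in $\mathbb{Z}_p$. -}

module Defs where

open import Data.Nat using (ℕ; zero; suc; _<ᵇ_; _≟_)
open import Data.Bool using (Bool; true; false; if_then_else_)
open import Data.List using (List; []; _∷_; map; concatMap; length; filter; upTo; sum)
open import Data.List.Relation.Unary.Unique.DecPropositional _≟_ using (unique?)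
open import Relation.Nullary.Decidable using (⌊_⌋)
open import Data.Integer using (ℤ; +_; -_; _-_)
import Data.Integer.Divisibility as ℤDiv

words : ℕ → ℕ → List (List ℕ)
words k zero    = [] ∷ []
words k (suc n) = concatMap (λ x → map (x ∷_) (words k n)) (map suc (upTo k))

permutations : ℕ → List (List ℕ)
permutations n = filter unique? (words n n)

ascents : List ℕ → ℕ
ascents []           = 0
ascents (x ∷ [])     = 0
ascents (x ∷ y ∷ xs) = (if x <ᵇ y then 1 else 0) Data.Nat.+ ascents (y ∷ xs)

E : ℕ → ℕ → ℕ
E n m = length (filter (λ σ → ascents σ ≟ m) (permutations n))

sgn : ℕ → ℤ
sgn zero    = + 1
sgn (suc m) = - sgn m

Σℤ : ℕ → (ℕ → ℤ) → ℤ
Σℤ n f = Data.List.foldr Data.Integer._+_ (+ 0) (map f (upTo n))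

_≡_[mod_] : ℤ → ℤ → ℤ → Set
a ≡ b [mod m ] = m ℤDiv.∣ (a - b)

-- Write p = 2q + 1 and n = 2k - 1. Classifying permutations by their first entry shows that the alternating
-- Eulerian sum Σ (-1)^m E(n,m) equals -α n, where α 0 = 1 and, umbrally, (2 + α)^e + α^e = 0 for e ≥ 1.
-- The numbers β e = Σ_{x<p} (-1)^x (2x)^e satisfy the same recurrence up to the term (2p)^e, so since p is
-- odd, induction gives β e ≡ α e + p e α (e - 1) (mod p²). The reflection x ↦ p - 1 - x shows that p divides
-- Σ_{x<p} (-1)^x x^(n-1), hence α (n - 1), so β n ≡ α n (mod p²); the reflection x ↦ p - x together with
-- p ∣ Σ_{x<p} x^(n-1) (p prime, n + 1 < p) gives p² ∣ Σ_{x<p} x^n. Finally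
-- 2^(n+1) Σ_{x<p, x odd} x^n = 2^n Σ_{x<p} x^n - β n ≡ -α n (mod p²).
module Submission where

open import Defs
open import Data.Bool using (Bool; true; false; if_then_else_; not; _∧_; _∨_)
open import Data.Bool.Properties using (∧-identityʳ; ∧-zeroʳ)
open import Data.Empty using (⊥; ⊥-elim)
open import Data.Integer as ℤ using (ℤ; +_; -_; _+_; _*_; _-_; _^_; -1ℤ)
import Data.Integer.Properties as ℤₚ
open import Data.Integer.Divisibility.Signed as ℤ∣ using (_∣_; divides)
open import Data.Integer.Tactic.RingSolver using (solve-∀)
open import Data.List using (List; []; _∷_; map; upTo; _++_; [_]; concatMap; filter; length; foldr)
import Data.List.Properties as Listₚ
open import Data.List.Relation.Unary.All as All using (All; []; _∷_)
import Data.List.Relation.Unary.All.Properties as Allₚ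
open import Data.Nat as ℕ using (ℕ; zero; suc; _≤_; _<_; z≤n; s≤s; _∸_; _%_; _≡ᵇ_; _<ᵇ_; _≤ᵇ_)
import Data.Nat.Properties as ℕₚ
import Data.Nat.Divisibility as ℕ∣
import Data.Nat.DivMod as ℕDM
open import Data.Nat.Combinatorics using (_C_; nCn≡1; nC1≡n; nCk≡nC[n∸k]; k>n⇒nCk≡0; nCk+nC[k+1]≡[n+1]C[k+1])
open import Data.Nat.Induction using (<-rec)
open import Data.Nat.Primality using (Prime; euclidsLemma; composite-≢; composite⇒¬prime)
open import Data.Nat.Tactic.RingSolver using () renaming (solve-∀ to ℕ-solve-∀)
open import Data.List.Relation.Unary.Unique.DecPropositional ℕ._≟_ using (unique?)
open import Data.Product using (∃-syntax; _,_)
open import Data.Sum using (_⊎_; inj₁; inj₂)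
open import Function using (_∘_)
open import Relation.Binary using (Setoid; tri<; tri≈; tri>)
open import Relation.Binary.PropositionalEquality hiding ([_])
open import Relation.Nullary using (¬_; does; yes; no; ¬?)
open import Relation.Nullary.Decidable using (Dec)
open import Relation.Nullary.Reflects using (Reflects; ofʸ; ofⁿ; det; fromEquivalence)

private variable
  i j : ℕ
  a d u x y z : ℤ

≡ᵇ-reflects-≡ : ∀ m n → Reflects (m ≡ n) (m ≡ᵇ n)
≡ᵇ-reflects-≡ m n = fromEquivalence (ℕₚ.≡ᵇ⇒≡ m n) (ℕₚ.≡⇒≡ᵇ m n)

≡ᵇ-refl : ∀ n → (n ≡ᵇ n) ≡ true
≡ᵇ-refl n = det (≡ᵇ-reflects-≡ n n) (ofʸ refl)

≢⇒≡ᵇ-false : i ≢ j → (i ≡ᵇ j) ≡ false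
≢⇒≡ᵇ-false {i} {j} = det (≡ᵇ-reflects-≡ i j) ∘ ofⁿ

<⇒<ᵇ-true : i < j → (i <ᵇ j) ≡ true
<⇒<ᵇ-true {i} {j} = det (ℕₚ.<ᵇ-reflects-< i j) ∘ ofʸ

≮⇒<ᵇ-false : ¬ i < j → (i <ᵇ j) ≡ false
≮⇒<ᵇ-false {i} {j} = det (ℕₚ.<ᵇ-reflects-< i j) ∘ ofⁿ

≤⇒≤ᵇ-true : i ≤ j → (i ≤ᵇ j) ≡ true
≤⇒≤ᵇ-true {i} {j} = det (ℕₚ.≤ᵇ-reflects-≤ i j) ∘ ofʸ

≰⇒≤ᵇ-false : ¬ i ≤ j → (i ≤ᵇ j) ≡ false
≰⇒≤ᵇ-false {i} {j} = det (ℕₚ.≤ᵇ-reflects-≤ i j) ∘ ofⁿ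

-- Finite sums

sumᶻ : List ℤ → ℤ
sumᶻ = foldr _+_ (+ 0)

sumᶻ-++ : ∀ xs ys → sumᶻ (xs ++ ys) ≡ sumᶻ xs + sumᶻ ys
sumᶻ-++ []       ys = sym (ℤₚ.+-identityˡ _)
sumᶻ-++ (x ∷ xs) ys = trans (cong (_+_ x) (sumᶻ-++ xs ys)) (sym (ℤₚ.+-assoc x _ _))

Σ< : ℕ → (ℕ → ℤ) → ℤ
Σ< zero    f = + 0
Σ< (suc n) f = Σ< n f + f n

Σℤ≡Σ< : ∀ n f → Σℤ n f ≡ Σ< n f
Σℤ≡Σ< zero    f = refl
Σℤ≡Σ< (suc n) f = begin
  sumᶻ (map f (upTo (suc n)))        ≡⟨ cong (sumᶻ ∘ map f) (sym (Listₚ.upTo-∷ʳ n)) ⟩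
  sumᶻ (map f (upTo n ++ [ n ]))     ≡⟨ cong sumᶻ (Listₚ.map-++ f (upTo n) [ n ]) ⟩
  sumᶻ (map f (upTo n) ++ [ f n ])   ≡⟨ sumᶻ-++ (map f (upTo n)) [ f n ] ⟩
  sumᶻ (map f (upTo n)) + (f n + + 0) ≡⟨ cong₂ _+_ (Σℤ≡Σ< n f) (ℤₚ.+-identityʳ (f n)) ⟩
  Σ< n f + f n                       ∎
  where open ≡-Reasoning

Σ<-cong : ∀ n {f g : ℕ → ℤ} → (∀ i → i < n → f i ≡ g i) → Σ< n f ≡ Σ< n g
Σ<-cong zero    f≡g = refl
Σ<-cong (suc n) f≡g = cong₂ _+_ (Σ<-cong n λ i i<n → f≡g i (ℕₚ.m<n⇒m<1+n i<n)) (f≡g n ℕₚ.≤-refl)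

Σ<-zero : ∀ n → Σ< n (λ _ → + 0) ≡ + 0
Σ<-zero zero    = refl
Σ<-zero (suc n) = cong (_+ + 0) (Σ<-zero n)

Σ<-distrib-+ : ∀ n (f g : ℕ → ℤ) → Σ< n (λ i → f i + g i) ≡ Σ< n f + Σ< n g
Σ<-distrib-+ zero    f g = refl
Σ<-distrib-+ (suc n) f g = trans (cong (_+ (f n + g n)) (Σ<-distrib-+ n f g)) (interchange (Σ< n f) (Σ< n g) (f n) (g n))
  where
  interchange : ∀ a b c d → (a + b) + (c + d) ≡ (a + c) + (b + d)
  interchange = solve-∀

Σ<-distribˡ-* : ∀ n c (f : ℕ → ℤ) → Σ< n (λ i → c * f i) ≡ c * Σ< n f
Σ<-distribˡ-* zero    c f = sym (ℤₚ.*-zeroʳ c)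
Σ<-distribˡ-* (suc n) c f =
  trans (cong (_+ c * f n) (Σ<-distribˡ-* n c f)) (sym (ℤₚ.*-distribˡ-+ c (Σ< n f) (f n)))

Σ<-neg : ∀ n (f : ℕ → ℤ) → Σ< n (λ i → - f i) ≡ - Σ< n f
Σ<-neg n f = begin
  Σ< n (λ i → - f i)     ≡⟨ Σ<-cong n (λ i _ → sym (ℤₚ.-1*i≡-i (f i))) ⟩
  Σ< n (λ i → -1ℤ * f i) ≡⟨ Σ<-distribˡ-* n -1ℤ f ⟩
  -1ℤ * Σ< n f           ≡⟨ ℤₚ.-1*i≡-i _ ⟩
  - Σ< n f               ∎
  where open ≡-Reasoning

Σ<-suc : ∀ n (f : ℕ → ℤ) → Σ< (suc n) f ≡ f 0 + Σ< n (f ∘ suc)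
Σ<-suc zero    f = ℤₚ.+-comm (+ 0) (f 0)
Σ<-suc (suc n) f = trans (cong (_+ f (suc n)) (Σ<-suc n f)) (ℤₚ.+-assoc (f 0) _ _)

Σ<-comm : ∀ n m (g : ℕ → ℕ → ℤ) → Σ< n (λ i → Σ< m (g i)) ≡ Σ< m (λ j → Σ< n (λ i → g i j))
Σ<-comm zero    m g = sym (Σ<-zero m)
Σ<-comm (suc n) m g = trans (cong (_+ Σ< m (g n)) (Σ<-comm n m g))
                            (sym (Σ<-distrib-+ m (λ j → Σ< n (λ i → g i j)) (g n)))

Σ<-reverse : ∀ n (f : ℕ → ℤ) → Σ< n f ≡ Σ< n (λ i → f (n ∸ suc i))
Σ<-reverse zero    f = refl
Σ<-reverse (suc n) f = begin
  Σ< n f + f n                             ≡⟨ cong (_+ f n) (Σ<-reverse n f) ⟩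
  Σ< n (λ i → f (n ∸ suc i)) + f n         ≡⟨ ℤₚ.+-comm _ (f n) ⟩
  f n + Σ< n (λ i → f (suc n ∸ suc (suc i))) ≡⟨ Σ<-suc n (λ i → f (suc n ∸ suc i)) ⟨
  Σ< (suc n) (λ i → f (suc n ∸ suc i))     ∎
  where open ≡-Reasoning

Σ<-shift : ∀ n (f : ℕ → ℤ) → Σ< n (f ∘ suc) ≡ Σ< n f + f n - f 0
Σ<-shift n f = begin
  Σ< n (f ∘ suc)                 ≡⟨ cancel (f 0) (Σ< n (f ∘ suc)) ⟩
  f 0 + Σ< n (f ∘ suc) - f 0     ≡⟨ cong (_- f 0) (Σ<-suc n f) ⟨
  Σ< n f + f n - f 0             ∎
  where
  open ≡-Reasoning
  cancel : ∀ a s → s ≡ a + s - a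
  cancel = solve-∀

Σ<-indicator : ∀ n j (f : ℕ → ℤ) → j < n → Σ< n (λ i → if j ≡ᵇ i then f i else + 0) ≡ f j
Σ<-indicator (suc n) j f j≤n with ℕₚ.m≤n⇒m<n∨m≡n j≤n
... | inj₂ refl = begin
  Σ< n (λ i → if n ≡ᵇ i then f i else + 0) + (if n ≡ᵇ n then f n else + 0)
    ≡⟨ cong₂ _+_ (trans (Σ<-cong n off-diagonal) (Σ<-zero n)) (cong (λ b → if b then f n else + 0) (≡ᵇ-refl n)) ⟩
  + 0 + f n ≡⟨ ℤₚ.+-identityˡ (f n) ⟩
  f n       ∎
  where
  open ≡-Reasoning
  off-diagonal : ∀ i → i < n → (if n ≡ᵇ i then f i else + 0) ≡ + 0
  off-diagonal i i<n rewrite ≢⇒≡ᵇ-false (ℕₚ.>⇒≢ i<n) = refl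
... | inj₁ (s≤s j<n) rewrite ≢⇒≡ᵇ-false (ℕₚ.<⇒≢ j<n) =
  trans (ℤₚ.+-identityʳ _) (Σ<-indicator n j f j<n)

-- Congruences of integers

-- The difference is wrapped in a record so that x, y and d stay inferable;
-- divisibility is the signed one, whose witness is an integer quotient.
infix 4 _≡_⟨mod_⟩
record _≡_⟨mod_⟩ (x y d : ℤ) : Set where
  constructor mod
  field divides-difference : d ∣ x - y
open _≡_⟨mod_⟩ public

≡⇒≡mod : x ≡ y → x ≡ y ⟨mod d ⟩
≡⇒≡mod {x} {d = d} refl = mod (divides (+ 0) (trans (ℤₚ.+-inverseʳ x) (sym (ℤₚ.*-zeroˡ d))))

≡mod-sym : x ≡ y ⟨mod d ⟩ → y ≡ x ⟨mod d ⟩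
≡mod-sym {x} {y} (mod d∣x-y) = mod (subst (_ ∣_) (difference x y) (ℤ∣.∣m⇒∣-m d∣x-y))
  where
  difference : ∀ x y → - (x - y) ≡ y - x
  difference = solve-∀

≡mod-trans : x ≡ y ⟨mod d ⟩ → y ≡ z ⟨mod d ⟩ → x ≡ z ⟨mod d ⟩
≡mod-trans {x} {y} {z = z} (mod p) (mod q) = mod (subst (_ ∣_) (telescope x y z) (ℤ∣.∣m∣n⇒∣m+n p q))
  where
  telescope : ∀ x y z → (x - y) + (y - z) ≡ x - z
  telescope = solve-∀

≡mod-setoid : ℤ → Setoid _ _
≡mod-setoid d = record
  { Carrier = ℤ
  ; _≈_ = λ x y → x ≡ y ⟨mod d ⟩
  ; isEquivalence = record { refl = ≡⇒≡mod refl ; sym = ≡mod-sym ; trans = ≡mod-trans }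
  }

module ≡mod-Reasoning (d : ℤ) where
  open import Relation.Binary.Reasoning.Setoid (≡mod-setoid d) public

+-cong-≡mod : x ≡ y ⟨mod d ⟩ → z ≡ u ⟨mod d ⟩ → x + z ≡ y + u ⟨mod d ⟩
+-cong-≡mod {x} {y} {z = z} {u} (mod p) (mod q) = mod (subst (_ ∣_) (regroup x y z u) (ℤ∣.∣m∣n⇒∣m+n p q))
  where
  regroup : ∀ x y z u → (x - y) + (z - u) ≡ (x + z) - (y + u)
  regroup = solve-∀

*-congˡ-≡mod : ∀ c → x ≡ y ⟨mod d ⟩ → c * x ≡ c * y ⟨mod d ⟩
*-congˡ-≡mod {x} {y} c (mod p) = mod (subst (_ ∣_) (distrib c x y) (ℤ∣.∣n⇒∣m*n c p))
  where
  distrib : ∀ c x y → c * (x - y) ≡ c * x - c * y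
  distrib = solve-∀

*-cong-≡mod : x ≡ y ⟨mod d ⟩ → z ≡ u ⟨mod d ⟩ → x * z ≡ y * u ⟨mod d ⟩
*-cong-≡mod {x} {y} {d} {z} {u} x≡y z≡u = begin
  x * z ≈⟨ *-congˡ-≡mod x z≡u ⟩
  x * u ≡⟨ ℤₚ.*-comm x u ⟩
  u * x ≈⟨ *-congˡ-≡mod u x≡y ⟩
  u * y ≡⟨ ℤₚ.*-comm u y ⟩
  y * u ∎
  where open ≡mod-Reasoning d

^-cong-≡mod : ∀ e → x ≡ y ⟨mod d ⟩ → x ^ e ≡ y ^ e ⟨mod d ⟩
^-cong-≡mod zero    x≡y = ≡⇒≡mod refl
^-cong-≡mod (suc e) x≡y = *-cong-≡mod x≡y (^-cong-≡mod e x≡y)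

neg-cong-≡mod : x ≡ y ⟨mod d ⟩ → - x ≡ - y ⟨mod d ⟩
neg-cong-≡mod {x} {y} (mod p) = mod (subst (_ ∣_) (negate x y) (ℤ∣.∣m⇒∣-m p))
  where
  negate : ∀ x y → - (x - y) ≡ - x - - y
  negate = solve-∀

≡+multiple⇒≡mod : ∀ z → x ≡ y + d * z → x ≡ y ⟨mod d ⟩
≡+multiple⇒≡mod {y = y} {d} z refl = mod (divides z (cancel y d z))
  where
  cancel : ∀ y d z → y + d * z - y ≡ z * d
  cancel = solve-∀

∣⇒≡0mod : d ∣ x → x ≡ + 0 ⟨mod d ⟩
∣⇒≡0mod {x = x} d∣x = mod (subst (_ ∣_) (sym (ℤₚ.+-identityʳ x)) d∣x)

≡0mod⇒∣ : x ≡ + 0 ⟨mod d ⟩ → d ∣ x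
≡0mod⇒∣ {x} (mod d∣x) = subst (_ ∣_) (ℤₚ.+-identityʳ x) d∣x

≡mod-weaken : a ∣ d → x ≡ y ⟨mod d ⟩ → x ≡ y ⟨mod a ⟩
≡mod-weaken a∣d (mod d∣x-y) = mod (ℤ∣.∣-trans a∣d d∣x-y)

Σ<-cong-≡mod : ∀ n {f g : ℕ → ℤ} → (∀ i → i < n → f i ≡ g i ⟨mod d ⟩) → Σ< n f ≡ Σ< n g ⟨mod d ⟩
Σ<-cong-≡mod zero    f≡g = ≡⇒≡mod refl
Σ<-cong-≡mod (suc n) f≡g =
  +-cong-≡mod (Σ<-cong-≡mod n λ i i<n → f≡g i (ℕₚ.m<n⇒m<1+n i<n)) (f≡g n ℕₚ.≤-refl)

∣-Σ< : ∀ n {f : ℕ → ℤ} → (∀ i → i < n → d ∣ f i) → d ∣ Σ< n f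
∣-Σ< n d∣f = ≡0mod⇒∣ (≡mod-trans (Σ<-cong-≡mod n λ i i<n → ∣⇒≡0mod (d∣f i i<n))
                                   (≡⇒≡mod (Σ<-zero n)))

odd∣2*⇒∣ : ∀ t → d ≡ + 2 * t + + 1 → d ∣ + 2 * x → d ∣ x
odd∣2*⇒∣ {x = x} t refl d∣2x =
  subst (_ ∣_) (bezout x t) (ℤ∣.∣m∣n⇒∣m+n (ℤ∣.∣m⇒∣m*n x ℤ∣.∣-refl) (ℤ∣.∣m⇒∣-m (ℤ∣.∣m⇒∣m*n t d∣2x)))
  where
  bezout : ∀ x t → (+ 2 * t + + 1) * x + - (+ 2 * x * t) ≡ x
  bezout = solve-∀

-- Binomial coefficients

pos-^ : ∀ m n → + (m ℕ.^ n) ≡ (+ m) ^ n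
pos-^ m zero    = refl
pos-^ m (suc n) = trans (ℤₚ.pos-* m (m ℕ.^ n)) (cong (_*_ (+ m)) (pos-^ m n))

binomial : ∀ e y → (+ 1 + y) ^ e ≡ Σ< (suc e) (λ k → + (e C k) * y ^ k)
binomial zero    y = refl
binomial (suc e) y = begin
  (+ 1 + y) * (+ 1 + y) ^ e                        ≡⟨ cong (_*_ (+ 1 + y)) (binomial e y) ⟩
  (+ 1 + y) * Σ< (suc e) f                         ≡⟨ expand (Σ< (suc e) f) y ⟩
  Σ< (suc e) f + y * Σ< (suc e) f                  ≡⟨ cong₂ _+_ (sym (Σ<-suc e f)) (Σ<-distribˡ-* (suc e) y f) ⟨
  (f 0 + Σ< e (f ∘ suc)) + Σ< (suc e) (λ k → y * f k)
    ≡⟨ cong (λ s → (f 0 + s) + Σ< (suc e) (λ k → y * f k)) top-term ⟩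
  (f 0 + Σ< (suc e) (f ∘ suc)) + Σ< (suc e) (λ k → y * f k)
    ≡⟨ trans (ℤₚ.+-assoc (f 0) (Σ< (suc e) (f ∘ suc)) (Σ< (suc e) (λ k → y * f k))) (cong (_+_ (f 0)) (sym (Σ<-distrib-+ (suc e) (f ∘ suc) (λ k → y * f k)))) ⟩
  f 0 + Σ< (suc e) (λ j → f (suc j) + y * f j)     ≡⟨ cong (_+_ (f 0)) (Σ<-cong (suc e) (λ j _ → pascal j)) ⟩
  f 0 + Σ< (suc e) (λ j → + (suc e C suc j) * y ^ suc j) ≡⟨ Σ<-suc (suc e) (λ k → + (suc e C k) * y ^ k) ⟨
  Σ< (suc (suc e)) (λ k → + (suc e C k) * y ^ k)  ∎
  where
  open ≡-Reasoning
  f : ℕ → ℤ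
  f k = + (e C k) * y ^ k
  expand : ∀ s y → (+ 1 + y) * s ≡ s + y * s
  expand = solve-∀
  top-term : Σ< e (f ∘ suc) ≡ Σ< (suc e) (f ∘ suc)
  top-term = sym (trans (cong (λ c → Σ< e (f ∘ suc) + + c * y ^ suc e) (k>n⇒nCk≡0 (ℕₚ.n<1+n e)))
                        (trans (cong (_+_ (Σ< e (f ∘ suc))) (ℤₚ.*-zeroˡ (y ^ suc e))) (ℤₚ.+-identityʳ _)))
  pascal : ∀ j → f (suc j) + y * f j ≡ + (suc e C suc j) * y ^ suc j
  pascal j = begin
    + (e C suc j) * (y * y ^ j) + y * (+ (e C j) * y ^ j) ≡⟨ collect (+ (e C j)) (+ (e C suc j)) y (y ^ j) ⟩
    (+ (e C j) + + (e C suc j)) * (y * y ^ j)           ≡⟨ cong (λ c → c * (y * y ^ j)) (ℤₚ.pos-+ (e C j) (e C suc j)) ⟨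
    + (e C j ℕ.+ e C suc j) * (y * y ^ j)               ≡⟨ cong (λ c → + c * y ^ suc j) (nCk+nC[k+1]≡[n+1]C[k+1] e j) ⟩
    + (suc e C suc j) * y ^ suc j                       ∎
    where
    collect : ∀ p q y w → q * (y * w) + y * (p * w) ≡ (p + q) * (y * w)
    collect = solve-∀

[k+1]*[n+1]C[k+1]≡[n+1]*nCk : ∀ n k → suc k ℕ.* (suc n C suc k) ≡ suc n ℕ.* (n C k)
[k+1]*[n+1]C[k+1]≡[n+1]*nCk zero    zero    = refl
[k+1]*[n+1]C[k+1]≡[n+1]*nCk zero    (suc k)
  rewrite k>n⇒nCk≡0 {1} {suc (suc k)} (s≤s (s≤s z≤n)) | k>n⇒nCk≡0 {0} {suc k} (s≤s z≤n) = ℕₚ.*-zeroʳ (suc (suc k))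
[k+1]*[n+1]C[k+1]≡[n+1]*nCk (suc n) zero    = trans (ℕₚ.*-identityˡ _) (trans (nC1≡n (suc (suc n))) (sym (ℕₚ.*-identityʳ _)))
[k+1]*[n+1]C[k+1]≡[n+1]*nCk (suc n) (suc k) = begin
  suc (suc k) ℕ.* (suc (suc n) C suc (suc k))           ≡⟨ cong (suc (suc k) ℕ.*_) (nCk+nC[k+1]≡[n+1]C[k+1] (suc n) (suc k)) ⟨
  suc (suc k) ℕ.* (X ℕ.+ suc n C suc (suc k))           ≡⟨ split (suc k) X (suc n C suc (suc k)) ⟩
  X ℕ.+ suc k ℕ.* X ℕ.+ suc (suc k) ℕ.* (suc n C suc (suc k))
    ≡⟨ cong₂ (λ u v → X ℕ.+ u ℕ.+ v) ([k+1]*[n+1]C[k+1]≡[n+1]*nCk n k) ([k+1]*[n+1]C[k+1]≡[n+1]*nCk n (suc k)) ⟩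
  X ℕ.+ suc n ℕ.* (n C k) ℕ.+ suc n ℕ.* (n C suc k)      ≡⟨ join X (suc n) (n C k) (n C suc k) ⟩
  X ℕ.+ suc n ℕ.* (n C k ℕ.+ n C suc k)                  ≡⟨ cong (λ c → X ℕ.+ suc n ℕ.* c) (nCk+nC[k+1]≡[n+1]C[k+1] n k) ⟩
  suc (suc n) ℕ.* X                                      ∎
  where
  open ≡-Reasoning
  X = suc n C suc k
  split : ∀ k a b → suc k ℕ.* (a ℕ.+ b) ≡ a ℕ.+ k ℕ.* a ℕ.+ suc k ℕ.* b
  split = ℕ-solve-∀
  join : ∀ a n x y → a ℕ.+ n ℕ.* x ℕ.+ n ℕ.* y ≡ a ℕ.+ n ℕ.* (x ℕ.+ y)
  join = ℕ-solve-∀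

[n+1]Cn≡n+1 : ∀ n → suc n C n ≡ suc n
[n+1]Cn≡n+1 n = begin
  suc n C n            ≡⟨ nCk≡nC[n∸k] (ℕₚ.n≤1+n n) ⟩
  suc n C (suc n ∸ n)  ≡⟨ cong (suc n C_) (ℕₚ.m+n∸n≡m 1 n) ⟩
  suc n C 1            ≡⟨ nC1≡n (suc n) ⟩
  suc n                ∎
  where open ≡-Reasoning

-- Alternating sums of Eulerian numbers

count : ℕ → (ℕ → Bool) → ℕ
count zero    P = 0
count (suc k) P = count k P ℕ.+ (if P k then 1 else 0)

count-cong : ∀ k {P Q : ℕ → Bool} → (∀ y → y < k → P y ≡ Q y) → count k P ≡ count k Q
count-cong zero    P≡Q = refl
count-cong (suc k) P≡Q = cong₂ ℕ._+_ (count-cong k λ y y<k → P≡Q y (ℕₚ.m<n⇒m<1+n y<k))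
                                      (cong (λ b → if b then 1 else 0) (P≡Q k ℕₚ.≤-refl))

count-mono : ∀ k {P Q : ℕ → Bool} → (∀ y → P y ≡ true → Q y ≡ true) → count k P ≤ count k Q
count-mono zero    P⇒Q = z≤n
count-mono (suc k) {P} {Q} P⇒Q = ℕₚ.+-mono-≤ (count-mono k P⇒Q) (indicator-mono (P k) (Q k) (P⇒Q k))
  where
  indicator-mono : ∀ a b → (a ≡ true → b ≡ true) → (if a then 1 else 0) ≤ (if b then 1 else 0)
  indicator-mono false b     _   = z≤n
  indicator-mono true  true  _   = ℕₚ.≤-refl
  indicator-mono true  false a⇒b with a⇒b refl
  ... | ()

count-true : ∀ k → count k (λ _ → true) ≡ k
count-true zero    = refl
count-true (suc k) = trans (cong (ℕ._+ 1) (count-true k)) (ℕₚ.+-comm k 1)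

count-suc : ∀ k {P : ℕ → Bool} → P k ≡ true → count (suc k) P ≡ suc (count k P)
count-suc k {P} Pk rewrite Pk = ℕₚ.+-comm (count k P) 1

count-below : ∀ k x P → x ≤ k → count k (λ y → P y ∧ (y <ᵇ x)) ≡ count x P
count-below zero    x P x≤0 rewrite ℕₚ.n≤0⇒n≡0 x≤0 = refl
count-below (suc k) x P x≤k with ℕₚ.m≤n⇒m<n∨m≡n x≤k
... | inj₂ refl = count-cong (suc k) λ y y<x → trans (cong (P y ∧_) (<⇒<ᵇ-true y<x)) (∧-identityʳ (P y))
... | inj₁ (s≤s x≤k′) rewrite ≮⇒<ᵇ-false (ℕₚ.≤⇒≯ x≤k′) | ∧-zeroʳ (P k) =
  trans (ℕₚ.+-identityʳ _) (count-below k x P x≤k′)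

count-remove : ∀ k j P → j < k → P j ≡ true → suc (count k (λ y → P y ∧ not (j ≡ᵇ y))) ≡ count k P
count-remove (suc k) j P j≤k Pj with ℕₚ.m≤n⇒m<n∨m≡n j≤k
... | inj₂ refl rewrite ≡ᵇ-refl k | ∧-zeroʳ (P k) | Pj =
  trans (cong suc (ℕₚ.+-identityʳ _))
        (trans (cong suc (count-cong k λ y y<k → trans (cong (λ b → P y ∧ not b) (≢⇒≡ᵇ-false (ℕₚ.>⇒≢ y<k)))
                                                         (∧-identityʳ (P y))))
               (sym (ℕₚ.+-comm (count k P) 1)))
... | inj₁ (s≤s j<k) rewrite ≢⇒≡ᵇ-false (ℕₚ.<⇒≢ j<k) | ∧-identityʳ (P k) =
  cong (ℕ._+ (if P k then 1 else 0)) (count-remove k j P j<k Pj)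

-- The i-th element of {y < k | Q y} contributes h i.
Σ<-by-rank : ∀ k (Q : ℕ → Bool) (h : ℕ → ℤ) →
  Σ< k (λ y → if Q y then h (count y Q) else + 0) ≡ Σ< (count k Q) h
Σ<-by-rank zero    Q h = refl
Σ<-by-rank (suc k) Q h with Q k
... | true  rewrite Σ<-by-rank k Q h | ℕₚ.+-comm (count k Q) 1 = refl
... | false rewrite Σ<-by-rank k Q h | ℕₚ.+-identityʳ (count k Q) = ℤₚ.+-identityʳ _

sumᶻ-map-cong : ∀ {A : Set} (L : List A) {f g : A → ℤ} → (∀ x → f x ≡ g x) → sumᶻ (map f L) ≡ sumᶻ (map g L)
sumᶻ-map-cong L f≡g = cong sumᶻ (Listₚ.map-cong f≡g L)

sumᶻ-map-∘ : ∀ {A B : Set} (L : List A) (g : A → B) (h : B → ℤ) → sumᶻ (map h (map g L)) ≡ sumᶻ (map (h ∘ g) L)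
sumᶻ-map-∘ L g h = cong sumᶻ (sym (Listₚ.map-∘ L))

sumᶻ-concatMap : ∀ {A B : Set} (L : List A) (g : A → List B) (h : B → ℤ) →
  sumᶻ (map h (concatMap g L)) ≡ sumᶻ (map (λ x → sumᶻ (map h (g x))) L)
sumᶻ-concatMap []      g h = refl
sumᶻ-concatMap (x ∷ L) g h = begin
  sumᶻ (map h (g x ++ concatMap g L))                 ≡⟨ cong sumᶻ (Listₚ.map-++ h (g x) (concatMap g L)) ⟩
  sumᶻ (map h (g x) ++ map h (concatMap g L))         ≡⟨ sumᶻ-++ (map h (g x)) _ ⟩
  sumᶻ (map h (g x)) + sumᶻ (map h (concatMap g L))   ≡⟨ cong (_+_ (sumᶻ (map h (g x)))) (sumᶻ-concatMap L g h) ⟩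
  sumᶻ (map (λ x → sumᶻ (map h (g x))) (x ∷ L))       ∎
  where open ≡-Reasoning

sumᶻ-map-zero : ∀ {A : Set} (L : List A) → sumᶻ (map (λ _ → + 0) L) ≡ + 0
sumᶻ-map-zero []      = refl
sumᶻ-map-zero (_ ∷ L) = cong (_+_ (+ 0)) (sumᶻ-map-zero L)

sumᶻ-map-neg : ∀ {A : Set} (L : List A) (f : A → ℤ) → sumᶻ (map (λ x → - f x) L) ≡ - sumᶻ (map f L)
sumᶻ-map-neg []      f = refl
sumᶻ-map-neg (x ∷ L) f = trans (cong (_+_ (- f x)) (sumᶻ-map-neg L f)) (sym (ℤₚ.neg-distrib-+ (f x) _))

sumᶻ-filter : ∀ {A : Set} {P : A → Set} (P? : ∀ x → Dec (P x)) (L : List A) (g : A → ℤ) →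
  sumᶻ (map g (filter P? L)) ≡ sumᶻ (map (λ x → if does (P? x) then g x else + 0) L)
sumᶻ-filter P? []      g = refl
sumᶻ-filter P? (x ∷ L) g with does (P? x)
... | true  = cong (_+_ (g x)) (sumᶻ-filter P? L g)
... | false = trans (sumᶻ-filter P? L g) (sym (ℤₚ.+-identityˡ _))

sumᶻ-by-fibres : ∀ n (c : ℕ → ℤ) (v : List ℕ → ℕ) (L : List (List ℕ)) → All (λ σ → v σ < n) L →
  Σ< n (λ m → c m * + length (filter (λ σ → v σ ℕ.≟ m) L)) ≡ sumᶻ (map (c ∘ v) L)
sumᶻ-by-fibres n c v []      _ = trans (Σ<-cong n λ m _ → ℤₚ.*-zeroʳ (c m)) (Σ<-zero n)
sumᶻ-by-fibres n c v (σ ∷ L) (vσ<n ∷ v<n) = begin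
  Σ< n (λ m → c m * + length (filter (λ τ → v τ ℕ.≟ m) (σ ∷ L)))
    ≡⟨ Σ<-cong n (λ m _ → split m) ⟩
  Σ< n (λ m → (if v σ ≡ᵇ m then c m else + 0) + c m * + length (filter (λ τ → v τ ℕ.≟ m) L))
    ≡⟨ Σ<-distrib-+ n _ _ ⟩
  Σ< n (λ m → if v σ ≡ᵇ m then c m else + 0) + Σ< n (λ m → c m * + length (filter (λ τ → v τ ℕ.≟ m) L))
    ≡⟨ cong₂ _+_ (Σ<-indicator n (v σ) c vσ<n) (sumᶻ-by-fibres n c v L v<n) ⟩
  c (v σ) + sumᶻ (map (c ∘ v) L) ∎
  where
  open ≡-Reasoning
  split : ∀ m → c m * + length (filter (λ τ → v τ ℕ.≟ m) (σ ∷ L))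
              ≡ (if v σ ≡ᵇ m then c m else + 0) + c m * + length (filter (λ τ → v τ ℕ.≟ m) L)
  split m with v σ ≡ᵇ m
  ... | true  = trans (ℤₚ.*-distribˡ-+ (c m) (+ 1) _) (cong (_+ c m * + length (filter (λ τ → v τ ℕ.≟ m) L)) (ℤₚ.*-identityʳ (c m)))
  ... | false = sym (ℤₚ.+-identityˡ _)

mark : ℕ → (ℕ → Bool) → ℕ → Bool
mark x U y = (x ≡ᵇ y) ∨ U y

none : (ℕ → Bool) → List ℕ → Bool
none f []       = true
none f (y ∷ ys) = not (f y) ∧ none f ys

distinctAvoiding : (ℕ → Bool) → List ℕ → Bool
distinctAvoiding U []      = true
distinctAvoiding U (x ∷ w) = not (U x) ∧ distinctAvoiding (mark x U) w

none-mark : ∀ x U w → none (mark x U) w ≡ none (x ≡ᵇ_) w ∧ none U w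
none-mark x U []      = refl
none-mark x U (y ∷ w) rewrite none-mark x U w with x ≡ᵇ y | U y
... | true  | _     = refl
... | false | true  = sym (∧-zeroʳ (none (x ≡ᵇ_) w))
... | false | false = refl

all?≢≡none : ∀ x w → does (All.all? (λ y → ¬? (x ℕ.≟ y)) w) ≡ none (x ≡ᵇ_) w
all?≢≡none x []      = refl
all?≢≡none x (y ∷ w) = cong (not (x ≡ᵇ y) ∧_) (all?≢≡none x w)

distinctAvoiding≡none∧unique : ∀ U w → distinctAvoiding U w ≡ none U w ∧ does (unique? w)
distinctAvoiding≡none∧unique U []      = refl
distinctAvoiding≡none∧unique U (x ∷ w)
  rewrite distinctAvoiding≡none∧unique (mark x U) w | none-mark x U w | all?≢≡none x w =
  regroup (not (U x)) (none (x ≡ᵇ_) w) (none U w) (does (unique? w))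
  where
  regroup : ∀ a b c d → a ∧ ((b ∧ c) ∧ d) ≡ (a ∧ c) ∧ (b ∧ d)
  regroup false b     c d = refl
  regroup true  false c d = sym (∧-zeroʳ c)
  regroup true  true  c d = refl

unique≡distinctAvoiding∅ : ∀ w → does (unique? w) ≡ distinctAvoiding (λ _ → false) w
unique≡distinctAvoiding∅ w =
  sym (trans (distinctAvoiding≡none∧unique (λ _ → false) w) (cong (_∧ does (unique? w)) (none-false w)))
  where
  none-false : ∀ w → none (λ _ → false) w ≡ true
  none-false []      = refl
  none-false (_ ∷ w) = none-false w

signedCount : ℕ → (ℕ → Bool) → ℕ → ℕ → ℤ
signedCount k U N prev = sumᶻ (map (λ w → if distinctAvoiding U w then sgn (ascents (prev ∷ w)) else + 0) (words k N))

sumᶻ-words-suc : ∀ k N (f : List ℕ → ℤ) →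
  sumᶻ (map f (words k (suc N))) ≡ Σ< k (λ x → sumᶻ (map (λ w → f (suc x ∷ w)) (words k N)))
sumᶻ-words-suc k N f = begin
  sumᶻ (map f (concatMap (λ x → map (x ∷_) (words k N)) (map suc (upTo k))))
    ≡⟨ sumᶻ-concatMap (map suc (upTo k)) _ f ⟩
  sumᶻ (map (λ x → sumᶻ (map f (map (x ∷_) (words k N)))) (map suc (upTo k)))
    ≡⟨ sumᶻ-map-∘ (upTo k) suc _ ⟩
  sumᶻ (map (λ x → sumᶻ (map f (map (suc x ∷_) (words k N)))) (upTo k))
    ≡⟨ sumᶻ-map-cong (upTo k) (λ x → sumᶻ-map-∘ (words k N) (suc x ∷_) f) ⟩
  Σℤ k (λ x → sumᶻ (map (λ w → f (suc x ∷ w)) (words k N)))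
    ≡⟨ Σℤ≡Σ< k _ ⟩
  Σ< k (λ x → sumᶻ (map (λ w → f (suc x ∷ w)) (words k N))) ∎
  where open ≡-Reasoning

signedCount-suc : ∀ k U N prev → signedCount k U (suc N) prev ≡
  Σ< k (λ x → if U (suc x) then + 0
              else if prev <ᵇ suc x then - signedCount k (mark (suc x) U) N (suc x)
              else signedCount k (mark (suc x) U) N (suc x))
signedCount-suc k U N prev =
  trans (sumᶻ-words-suc k N _) (Σ<-cong k λ x _ → first-letter (suc x))
  where
  first-letter : ∀ x → sumᶻ (map (λ w → if distinctAvoiding U (x ∷ w) then sgn (ascents (prev ∷ x ∷ w)) else + 0) (words k N))
    ≡ (if U x then + 0 else if prev <ᵇ x then - signedCount k (mark x U) N x else signedCount k (mark x U) N x)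
  first-letter x with U x
  ... | true  = sumᶻ-map-zero (words k N)
  ... | false with prev <ᵇ x
  ...   | false = refl
  ...   | true  = trans (sumᶻ-map-cong (words k N) λ w → if-neg (distinctAvoiding (mark x U) w))
                        (sumᶻ-map-neg (words k N) _)
    where
    if-neg : ∀ b {s} → (if b then - s else + 0) ≡ - (if b then s else + 0)
    if-neg true  = refl
    if-neg false = refl

-- signedByRank N r is the signed count of arrangements w of N values after an entry exceeding exactly r of them.
signedByRank : ℕ → ℕ → ℤ
signedByRank zero    r = + 1
signedByRank (suc N) r = Σ< (suc N) (λ i → if r ≤ᵇ i then - signedByRank N i else signedByRank N i)

-- The letter set is {1, …, k}; the index y stands for the letter suc y.
free : (ℕ → Bool) → ℕ → Bool
free U y = not (U (suc y))

rank : ℕ → (ℕ → Bool) → ℕ → ℕ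
rank k U prev = count k (λ y → free U y ∧ (suc y <ᵇ prev))

count-free-mark : ∀ k U x → x < k → U (suc x) ≡ false →
  suc (count k (free (mark (suc x) U))) ≡ count k (free U)
count-free-mark k U x x<k Ux =
  trans (cong suc (count-cong k λ y _ → deMorgan (x ≡ᵇ y) (U (suc y)))) (count-remove k x (free U) x<k (cong not Ux))
  where
  deMorgan : ∀ a b → not (a ∨ b) ≡ not b ∧ not a
  deMorgan true  b = sym (∧-zeroʳ (not b))
  deMorgan false b = sym (∧-identityʳ (not b))

rank-mark : ∀ k U x → x < k → rank k (mark (suc x) U) (suc x) ≡ count x (free U)
rank-mark k U x x<k = trans (count-cong k agree) (count-below k x (free U) (ℕₚ.<⇒≤ x<k))
  where
  agree : ∀ y → y < k → (not ((x ≡ᵇ y) ∨ U (suc y)) ∧ (y <ᵇ x)) ≡ (free U y ∧ (y <ᵇ x))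
  agree y _ with y <ᵇ x | ℕₚ.<ᵇ-reflects-< y x
  ... | false | _        = trans (∧-zeroʳ _) (sym (∧-zeroʳ _))
  ... | true  | ofʸ y<x rewrite ≢⇒≡ᵇ-false (ℕₚ.>⇒≢ y<x) = refl

-- Since prev is used and suc x is free, prev < suc x exactly when every free letter below prev lies below suc x.
ascent≡rank≤ : ∀ k U prev x → U prev ≡ true → U (suc x) ≡ false → x < k →
  (prev <ᵇ suc x) ≡ (rank k U prev ≤ᵇ count x (free U))
ascent≡rank≤ k U prev x Uprev Ux x<k with prev ℕ.≤? x
... | yes prev≤x = trans (<⇒<ᵇ-true (s≤s prev≤x)) (sym (≤⇒≤ᵇ-true (begin
  rank k U prev                            ≤⟨ count-mono k below-prev⇒below-x ⟩
  count k (λ y → free U y ∧ (y <ᵇ x))    ≡⟨ count-below k x (free U) (ℕₚ.<⇒≤ x<k) ⟩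
  count x (free U)                         ∎)))
  where
  open ℕₚ.≤-Reasoning
  below-prev⇒below-x : ∀ y → (free U y ∧ (suc y <ᵇ prev)) ≡ true → (free U y ∧ (y <ᵇ x)) ≡ true
  below-prev⇒below-x y e with free U y | suc y <ᵇ prev | ℕₚ.<ᵇ-reflects-< (suc y) prev
  ... | true | true | ofʸ y<prev = <⇒<ᵇ-true (ℕₚ.<-≤-trans (ℕₚ.m<n⇒m<1+n ℕₚ.≤-refl) (ℕₚ.<-≤-trans y<prev prev≤x))
... | no prev≰x = trans (≮⇒<ᵇ-false (prev≰x ∘ ℕₚ.≤-pred)) (sym (≰⇒≤ᵇ-false (ℕₚ.<⇒≱ (begin-strict
  count x (free U)                                   <⟨ ℕₚ.n<1+n _ ⟩
  suc (count x (free U))                             ≡⟨ count-suc x (cong not Ux) ⟨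
  count (suc x) (free U)                             ≡⟨ count-below k (suc x) (free U) x<k ⟨
  count k (λ y → free U y ∧ (y <ᵇ suc x))          ≤⟨ count-mono k below-x⇒below-prev ⟩
  rank k U prev                                      ∎))))
  where
  open ℕₚ.≤-Reasoning
  x<prev : suc x < prev
  x<prev = ℕₚ.≤∧≢⇒< (ℕₚ.≰⇒> prev≰x) λ x≡prev → contradiction (trans (sym Ux) (trans (cong U x≡prev) Uprev))
    where
    contradiction : false ≡ true → ⊥
    contradiction ()
  below-x⇒below-prev : ∀ y → (free U y ∧ (y <ᵇ suc x)) ≡ true → (free U y ∧ (suc y <ᵇ prev)) ≡ true
  below-x⇒below-prev y e with free U y | y <ᵇ suc x | ℕₚ.<ᵇ-reflects-< y (suc x)
  ... | true | true | ofʸ y<x = <⇒<ᵇ-true (ℕₚ.≤-<-trans y<x x<prev)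

signedCount≡signedByRank : ∀ N k U prev → U prev ≡ true → count k (free U) ≡ N →
  signedCount k U N prev ≡ signedByRank N (rank k U prev)
signedCount≡signedByRank zero    k U prev _     _     = refl
signedCount≡signedByRank (suc N) k U prev Uprev #free = begin
  signedCount k U (suc N) prev                               ≡⟨ signedCount-suc k U N prev ⟩
  Σ< k _                                                     ≡⟨ Σ<-cong k by-first-letter ⟩
  Σ< k (λ x → if free U x then h (count x (free U)) else + 0) ≡⟨ Σ<-by-rank k (free U) h ⟩
  Σ< (count k (free U)) h                                    ≡⟨ cong (λ n → Σ< n h) #free ⟩
  signedByRank (suc N) (rank k U prev)                       ∎
  where
  open ≡-Reasoning
  h : ℕ → ℤ
  h i = if rank k U prev ≤ᵇ i then - signedByRank N i else signedByRank N i
  by-first-letter : ∀ x → x < k →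
    (if U (suc x) then + 0
     else if prev <ᵇ suc x then - signedCount k (mark (suc x) U) N (suc x)
     else signedCount k (mark (suc x) U) N (suc x))
    ≡ (if free U x then h (count x (free U)) else + 0)
  by-first-letter x x<k with U (suc x) in Ux
  ... | true  = refl
  ... | false
    rewrite ascent≡rank≤ k U prev x Uprev Ux x<k
          | signedCount≡signedByRank N k (mark (suc x) U) (suc x) (cong (_∨ U (suc x)) (≡ᵇ-refl x))
              (ℕₚ.suc-injective (trans (count-free-mark k U x x<k Ux) #free))
          | rank-mark k U x x<k = refl

words-length : ∀ k N → All (λ w → length w ≡ N) (words k N)
words-length k zero    = refl ∷ []
words-length k (suc N) = Allₚ.concat⁺ (Allₚ.map⁺ (prepend (map suc (upTo k))))
  where
  prepend : ∀ xs → All (λ x → All (λ w → length w ≡ suc N) (map (x ∷_) (words k N))) xs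
  prepend []       = []
  prepend (x ∷ xs) = Allₚ.map⁺ (All.map (cong suc) (words-length k N)) ∷ prepend xs

ascents-∷-≤ : ∀ x w → ascents (x ∷ w) ≤ length w
ascents-∷-≤ x []      = z≤n
ascents-∷-≤ x (y ∷ w) with x <ᵇ y
... | true  = s≤s (ascents-∷-≤ y w)
... | false = ℕₚ.m≤n⇒m≤1+n (ascents-∷-≤ y w)

ascents<length : ∀ N → All (λ σ → ascents σ < suc N) (permutations (suc N))
ascents<length N = All.map (λ {σ} → bound σ) (Allₚ.filter⁺ unique? (words-length (suc N) (suc N)))
  where
  bound : ∀ σ → length σ ≡ suc N → ascents σ < suc N
  bound (x ∷ w) refl = s≤s (ascents-∷-≤ x w)

alternating-Eulerian : ∀ N → Σℤ (suc N) (λ m → sgn m * + E (suc N) m) ≡ Σ< (suc N) (signedByRank N)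
alternating-Eulerian N = begin
  Σℤ n (λ m → sgn m * + E n m)
    ≡⟨ Σℤ≡Σ< n _ ⟩
  Σ< n (λ m → sgn m * + E n m)
    ≡⟨ sumᶻ-by-fibres n sgn ascents (permutations n) (ascents<length N) ⟩
  sumᶻ (map (sgn ∘ ascents) (permutations n))
    ≡⟨ sumᶻ-filter unique? (words n n) (sgn ∘ ascents) ⟩
  sumᶻ (map (λ w → if does (unique? w) then sgn (ascents w) else + 0) (words n n))
    ≡⟨ sumᶻ-map-cong (words n n) (λ w → cong (λ b → if b then sgn (ascents w) else + 0) (unique≡distinctAvoiding∅ w)) ⟩
  sumᶻ (map (λ w → if distinctAvoiding (λ _ → false) w then sgn (ascents w) else + 0) (words n n))
    ≡⟨ sumᶻ-words-suc n N _ ⟩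
  Σ< n (λ x → signedCount n (mark (suc x) (λ _ → false)) N (suc x))
    ≡⟨ Σ<-cong n first-letter ⟩
  Σ< n (signedByRank N) ∎
  where
  open ≡-Reasoning
  n = suc N
  first-letter : ∀ x → x < n → signedCount n (mark (suc x) (λ _ → false)) N (suc x) ≡ signedByRank N x
  first-letter x x<n = begin
    signedCount n (mark (suc x) (λ _ → false)) N (suc x)
      ≡⟨ signedCount≡signedByRank N n _ (suc x) (cong (_∨ false) (≡ᵇ-refl x))
           (ℕₚ.suc-injective (trans (count-free-mark n (λ _ → false) x x<n refl) (count-true n))) ⟩
    signedByRank N (rank n (mark (suc x) (λ _ → false)) (suc x))
      ≡⟨ cong (signedByRank N) (trans (rank-mark n (λ _ → false) x x<n) (count-true x)) ⟩
    signedByRank N x ∎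

-- The recurrence for α

coeff : ℕ → ℕ → ℤ
coeff r k = + (r C k) * (+ 2) ^ (r ∸ k)

coeff-pascal : ∀ r k → coeff (suc r) (suc k) ≡ coeff r k + + 2 * coeff r (suc k)
coeff-pascal r k with ℕ.<-cmp k r
... | tri< k<r _ _ = begin
  + (suc r C suc k) * (+ 2) ^ (r ∸ k)
    ≡⟨ cong (λ e → + (suc r C suc k) * (+ 2) ^ e) (ℕₚ.+-∸-assoc 1 k<r) ⟩
  + (suc r C suc k) * (+ 2) ^ suc (r ∸ suc k)
    ≡⟨ cong (λ c → + c * (+ 2) ^ suc (r ∸ suc k)) (nCk+nC[k+1]≡[n+1]C[k+1] r k) ⟨
  + (r C k ℕ.+ r C suc k) * (+ 2) ^ suc (r ∸ suc k)
    ≡⟨ cong (_* (+ 2) ^ suc (r ∸ suc k)) (ℤₚ.pos-+ (r C k) (r C suc k)) ⟩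
  (+ (r C k) + + (r C suc k)) * (+ 2 * (+ 2) ^ (r ∸ suc k))
    ≡⟨ distribute (+ (r C k)) (+ (r C suc k)) ((+ 2) ^ (r ∸ suc k)) ⟩
  + (r C k) * (+ 2) ^ suc (r ∸ suc k) + + 2 * (+ (r C suc k) * (+ 2) ^ (r ∸ suc k))
    ≡⟨ cong (λ e → + (r C k) * (+ 2) ^ e + + 2 * (+ (r C suc k) * (+ 2) ^ (r ∸ suc k))) (ℕₚ.+-∸-assoc 1 k<r) ⟨
  + (r C k) * (+ 2) ^ (r ∸ k) + + 2 * (+ (r C suc k) * (+ 2) ^ (r ∸ suc k)) ∎
  where
  open ≡-Reasoning
  distribute : ∀ a b w → (a + b) * (+ 2 * w) ≡ a * (+ 2 * w) + + 2 * (b * w)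
  distribute = solve-∀
... | tri≈ _ refl _ = top-row (ℕₚ.n<1+n k)
  where
  top-row : k < suc k → coeff (suc k) (suc k) ≡ coeff k k + + 2 * coeff k (suc k)
  top-row k<1+k rewrite nCn≡1 (suc k) | nCn≡1 k | k>n⇒nCk≡0 k<1+k | ℕₚ.n∸n≡0 k = refl
... | tri> _ _ r<k rewrite k>n⇒nCk≡0 r<k | k>n⇒nCk≡0 (ℕₚ.m<n⇒m<1+n r<k) | k>n⇒nCk≡0 (s≤s r<k) = refl

Σ<-coeff-suc : ∀ r (y : ℕ → ℤ) →
  Σ< (suc r) (λ k → coeff r k * y (suc k)) + + 2 * Σ< (suc r) (λ k → coeff r k * y k)
    ≡ Σ< (suc (suc r)) (λ k → coeff (suc r) k * y k)
Σ<-coeff-suc r y = begin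
  A + + 2 * Σ< (suc r) (λ k → coeff r k * y k)
    ≡⟨ cong (λ s → A + + 2 * s) (Σ<-suc r (λ k → coeff r k * y k)) ⟩
  A + + 2 * (coeff r 0 * y 0 + B r)
    ≡⟨ cong (λ s → A + + 2 * (coeff r 0 * y 0 + s)) B-top ⟩
  A + + 2 * (coeff r 0 * y 0 + B (suc r))
    ≡⟨ regroup A ((+ 2) ^ r) (y 0) (B (suc r)) ⟩
  coeff (suc r) 0 * y 0 + (A + + 2 * B (suc r))
    ≡⟨ cong (_+_ (coeff (suc r) 0 * y 0)) (trans (Σ<-distrib-+ (suc r) _ _) (cong (_+_ A) (Σ<-distribˡ-* (suc r) (+ 2) _))) ⟨
  coeff (suc r) 0 * y 0 + Σ< (suc r) (λ k → coeff r k * y (suc k) + + 2 * (coeff r (suc k) * y (suc k)))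
    ≡⟨ cong (_+_ (coeff (suc r) 0 * y 0)) (Σ<-cong (suc r) λ k _ → pascal k) ⟩
  coeff (suc r) 0 * y 0 + Σ< (suc r) (λ k → coeff (suc r) (suc k) * y (suc k))
    ≡⟨ Σ<-suc (suc r) (λ k → coeff (suc r) k * y k) ⟨
  Σ< (suc (suc r)) (λ k → coeff (suc r) k * y k) ∎
  where
  open ≡-Reasoning
  A = Σ< (suc r) (λ k → coeff r k * y (suc k))
  B : ℕ → ℤ
  B n = Σ< n (λ k → coeff r (suc k) * y (suc k))
  B-top : B r ≡ B (suc r)
  B-top rewrite k>n⇒nCk≡0 (ℕₚ.n<1+n r) = sym (trans (cong (_+_ (B r)) (ℤₚ.*-zeroˡ (y (suc r)))) (ℤₚ.+-identityʳ (B r)))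
  regroup : ∀ a w y₀ b → a + + 2 * (+ 1 * w * y₀ + b) ≡ + 1 * (+ 2 * w) * y₀ + (a + + 2 * b)
  regroup = solve-∀
  pascal : ∀ k → coeff r k * y (suc k) + + 2 * (coeff r (suc k) * y (suc k)) ≡ coeff (suc r) (suc k) * y (suc k)
  pascal k = trans (distribute (coeff r k) (coeff r (suc k)) (y (suc k))) (cong (_* y (suc k)) (sym (coeff-pascal r k)))
    where
    distribute : ∀ a b z → a * z + + 2 * (b * z) ≡ (a + + 2 * b) * z
    distribute = solve-∀

signedByRank-suc-rank : ∀ N r → r < suc N →
  signedByRank (suc N) (suc r) ≡ signedByRank (suc N) r + + 2 * signedByRank N r
signedByRank-suc-rank N r r≤N = begin
  signedByRank (suc N) (suc r)
    ≡⟨ Σ<-cong (suc N) (λ i _ → split i) ⟩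
  Σ< (suc N) (λ i → (if r ≤ᵇ i then - t i else t i) + (if r ≡ᵇ i then + 2 * t i else + 0))
    ≡⟨ Σ<-distrib-+ (suc N) _ _ ⟩
  signedByRank (suc N) r + Σ< (suc N) (λ i → if r ≡ᵇ i then + 2 * t i else + 0)
    ≡⟨ cong (_+_ (signedByRank (suc N) r)) (Σ<-indicator (suc N) r (λ i → + 2 * t i) r≤N) ⟩
  signedByRank (suc N) r + + 2 * t r ∎
  where
  open ≡-Reasoning
  t = signedByRank N
  split : ∀ i → (if suc r ≤ᵇ i then - t i else t i)
              ≡ (if r ≤ᵇ i then - t i else t i) + (if r ≡ᵇ i then + 2 * t i else + 0)
  split i with ℕ.<-cmp r i
  ... | tri< r<i _ _ rewrite ≤⇒≤ᵇ-true r<i | ≤⇒≤ᵇ-true (ℕₚ.<⇒≤ r<i) | ≢⇒≡ᵇ-false (ℕₚ.<⇒≢ r<i) =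
    sym (ℤₚ.+-identityʳ _)
  ... | tri≈ _ refl _ rewrite ≰⇒≤ᵇ-false (ℕₚ.n≮n r) | ≤⇒≤ᵇ-true (ℕₚ.≤-refl {r}) | ≡ᵇ-refl r = flip (t r)
    where
    flip : ∀ s → s ≡ - s + + 2 * s
    flip = solve-∀
  ... | tri> _ _ i<r rewrite ≰⇒≤ᵇ-false (ℕₚ.<⇒≱ (ℕₚ.m<n⇒m<1+n i<r)) | ≰⇒≤ᵇ-false (ℕₚ.<⇒≱ i<r)
                           | ≢⇒≡ᵇ-false (ℕₚ.>⇒≢ i<r) = sym (ℤₚ.+-identityʳ _)

α : ℕ → ℤ
α n = signedByRank n 0

signedByRank-closed : ∀ r d → signedByRank (r ℕ.+ d) r ≡ Σ< (suc r) (λ k → coeff r k * α (d ℕ.+ k))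
signedByRank-closed zero    d = trans (cong α (sym (ℕₚ.+-identityʳ d))) (unit (α (d ℕ.+ 0)))
  where
  unit : ∀ x → x ≡ + 0 + + 1 * + 1 * x
  unit = solve-∀
signedByRank-closed (suc r) d = begin
  signedByRank (suc (r ℕ.+ d)) (suc r)
    ≡⟨ signedByRank-suc-rank (r ℕ.+ d) r (s≤s (ℕₚ.m≤m+n r d)) ⟩
  signedByRank (suc (r ℕ.+ d)) r + + 2 * signedByRank (r ℕ.+ d) r
    ≡⟨ cong₂ (λ s t → s + + 2 * t) shifted (signedByRank-closed r d) ⟩
  Σ< (suc r) (λ k → coeff r k * α (d ℕ.+ suc k)) + + 2 * Σ< (suc r) (λ k → coeff r k * α (d ℕ.+ k))
    ≡⟨ Σ<-coeff-suc r (λ k → α (d ℕ.+ k)) ⟩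
  Σ< (suc (suc r)) (λ k → coeff (suc r) k * α (d ℕ.+ k)) ∎
  where
  open ≡-Reasoning
  shifted : signedByRank (suc (r ℕ.+ d)) r ≡ Σ< (suc r) (λ k → coeff r k * α (d ℕ.+ suc k))
  shifted = begin
    signedByRank (suc (r ℕ.+ d)) r              ≡⟨ cong (λ n → signedByRank n r) (ℕₚ.+-suc r d) ⟨
    signedByRank (r ℕ.+ suc d) r                ≡⟨ signedByRank-closed r (suc d) ⟩
    Σ< (suc r) (λ k → coeff r k * α (suc d ℕ.+ k)) ≡⟨ Σ<-cong (suc r) (λ k _ → cong (λ n → coeff r k * α n) (ℕₚ.+-suc d k)) ⟨
    Σ< (suc r) (λ k → coeff r k * α (d ℕ.+ suc k)) ∎

signedByRank-diagonal : ∀ N → signedByRank (suc N) (suc N) ≡ Σ< (suc N) (signedByRank N)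
signedByRank-diagonal N = Σ<-cong (suc N) λ i i≤N →
  cong (λ b → if b then - signedByRank N i else signedByRank N i) (≰⇒≤ᵇ-false (ℕₚ.<⇒≱ i≤N))

α-suc : ∀ N → α (suc N) ≡ - Σ< (suc N) (signedByRank N)
α-suc N = Σ<-neg (suc N) (signedByRank N)

alternating-Eulerian≡-α : ∀ N → Σℤ (suc N) (λ m → sgn m * + E (suc N) m) ≡ - α (suc N)
alternating-Eulerian≡-α N = begin
  Σℤ (suc N) (λ m → sgn m * + E (suc N) m) ≡⟨ alternating-Eulerian N ⟩
  Σ< (suc N) (signedByRank N)              ≡⟨ ℤₚ.neg-involutive _ ⟨
  - - Σ< (suc N) (signedByRank N)          ≡⟨ cong -_ (α-suc N) ⟨
  - α (suc N)                              ∎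
  where open ≡-Reasoning

-- L x e is (2 + x)^e + x^e, where x^k is read as x k.
L : (ℕ → ℤ) → ℕ → ℤ
L x e = + 2 * x e + Σ< e (λ k → coeff e k * x k)

L-α : ∀ N → L α (suc N) ≡ + 0
L-α N = solve-for (α m) (Σ< m (λ k → coeff m k * α k)) (begin
  - α m                                            ≡⟨ cong -_ (α-suc N) ⟩
  - - Σ< m (signedByRank N)                        ≡⟨ ℤₚ.neg-involutive _ ⟩
  Σ< m (signedByRank N)                            ≡⟨ signedByRank-diagonal N ⟨
  signedByRank m m                                 ≡⟨ cong (λ n → signedByRank n m) (ℕₚ.+-identityʳ m) ⟨
  signedByRank (m ℕ.+ 0) m                         ≡⟨ signedByRank-closed m 0 ⟩
  Σ< m (λ k → coeff m k * α k) + coeff m m * α m   ≡⟨ cong (λ c → Σ< m (λ k → coeff m k * α k) + c * α m) coeff-diagonal ⟩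
  Σ< m (λ k → coeff m k * α k) + + 1 * α m         ∎)
  where
  open ≡-Reasoning
  m = suc N
  coeff-diagonal : coeff m m ≡ + 1
  coeff-diagonal rewrite nCn≡1 m | ℕₚ.n∸n≡0 m = refl
  solve-for : ∀ a s → - a ≡ s + + 1 * a → + 2 * a + s ≡ + 0
  solve-for a s -a≡s+a = begin
    + 2 * a + s                ≡⟨ isolate a s ⟩
    + 2 * a + (s + + 1 * a) - a ≡⟨ cong (λ t → + 2 * a + t - a) -a≡s+a ⟨
    + 2 * a + - a - a          ≡⟨ cancel a ⟩
    + 0                        ∎
    where
    isolate : ∀ a s → + 2 * a + s ≡ + 2 * a + (s + + 1 * a) - a
    isolate = solve-∀
    cancel : ∀ a → + 2 * a + - a - a ≡ + 0
    cancel = solve-∀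

-- Power sums

powerSum : ℕ → ℕ → ℤ
powerSum M e = Σ< M (λ x → (+ x) ^ e)

altPowerSum : ℕ → ℕ → ℤ
altPowerSum M e = Σ< M (λ x → sgn x * (+ x) ^ e)

Σ<-binomial : ∀ M (w : ℕ → ℤ) e →
  Σ< M (λ x → w x * (+ suc x) ^ e) ≡ Σ< (suc e) (λ k → + (e C k) * Σ< M (λ x → w x * (+ x) ^ k))
Σ<-binomial M w e = begin
  Σ< M (λ x → w x * (+ suc x) ^ e)
    ≡⟨ Σ<-cong M (λ x _ → cong (w x *_) (binomial e (+ x))) ⟩
  Σ< M (λ x → w x * Σ< (suc e) (λ k → + (e C k) * (+ x) ^ k))
    ≡⟨ Σ<-cong M (λ x _ → sym (Σ<-distribˡ-* (suc e) (w x) _)) ⟩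
  Σ< M (λ x → Σ< (suc e) (λ k → w x * (+ (e C k) * (+ x) ^ k)))
    ≡⟨ Σ<-comm M (suc e) _ ⟩
  Σ< (suc e) (λ k → Σ< M (λ x → w x * (+ (e C k) * (+ x) ^ k)))
    ≡⟨ Σ<-cong (suc e) (λ k _ → trans (Σ<-cong M λ x _ → swap (w x) (+ (e C k)) ((+ x) ^ k)) (Σ<-distribˡ-* M (+ (e C k)) _)) ⟩
  Σ< (suc e) (λ k → + (e C k) * Σ< M (λ x → w x * (+ x) ^ k)) ∎
  where
  open ≡-Reasoning
  swap : ∀ w c y → w * (c * y) ≡ c * (w * y)
  swap = solve-∀

C[n,n]-* : ∀ n x → + (n C n) * x ≡ x
C[n,n]-* n x rewrite nCn≡1 n = ℤₚ.*-identityˡ x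

powerSum-shift : ∀ M e → Σ< M (λ x → (+ suc x) ^ suc e) ≡ powerSum M (suc e) + (+ M) ^ suc e
powerSum-shift M e = trans (Σ<-shift M (λ x → (+ x) ^ suc e)) (ℤₚ.+-identityʳ _)

altPowerSum-shift : ∀ M e →
  Σ< M (λ x → sgn x * (+ suc x) ^ suc e) ≡ - (altPowerSum M (suc e) + sgn M * (+ M) ^ suc e)
altPowerSum-shift M e = begin
  Σ< M (λ x → sgn x * (+ suc x) ^ suc e)           ≡⟨ Σ<-cong M (λ x _ → sign-flip (sgn x) _) ⟩
  Σ< M (λ x → - (sgn (suc x) * (+ suc x) ^ suc e)) ≡⟨ Σ<-neg M _ ⟩
  - Σ< M (λ x → sgn (suc x) * (+ suc x) ^ suc e)   ≡⟨ cong -_ (Σ<-shift M (λ x → sgn x * (+ x) ^ suc e)) ⟩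
  - (altPowerSum M (suc e) + sgn M * (+ M) ^ suc e - + 0) ≡⟨ cong -_ (ℤₚ.+-identityʳ _) ⟩
  - (altPowerSum M (suc e) + sgn M * (+ M) ^ suc e) ∎
  where
  open ≡-Reasoning
  sign-flip : ∀ s v → s * v ≡ - (- s * v)
  sign-flip = solve-∀

powerSum-recurrence : ∀ M e → Σ< (suc e) (λ k → + (suc e C k) * powerSum M k) ≡ (+ M) ^ suc e
powerSum-recurrence M e = cancelʳ (begin
  Σ< (suc e) (λ k → + (suc e C k) * powerSum M k) + powerSum M (suc e)
    ≡⟨ cong (_+_ (Σ< (suc e) (λ k → + (suc e C k) * powerSum M k))) (C[n,n]-* (suc e) _) ⟨
  Σ< (suc (suc e)) (λ k → + (suc e C k) * powerSum M k)
    ≡⟨ Σ<-cong (suc (suc e)) (λ k _ → cong (+ (suc e C k) *_) (Σ<-cong M λ x _ → sym (ℤₚ.*-identityˡ _))) ⟩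
  Σ< (suc (suc e)) (λ k → + (suc e C k) * Σ< M (λ x → + 1 * (+ x) ^ k))
    ≡⟨ Σ<-binomial M (λ _ → + 1) (suc e) ⟨
  Σ< M (λ x → + 1 * (+ suc x) ^ suc e)
    ≡⟨ Σ<-cong M (λ x _ → ℤₚ.*-identityˡ _) ⟩
  Σ< M (λ x → (+ suc x) ^ suc e)
    ≡⟨ powerSum-shift M e ⟩
  powerSum M (suc e) + (+ M) ^ suc e ∎)
  where
  open ≡-Reasoning
  cancelʳ : ∀ {s p m} → s + p ≡ p + m → s ≡ m
  cancelʳ {s} {p} {m} e = trans (isolate s p) (trans (cong (_- p) e) (cancel p m))
    where
    isolate : ∀ s p → s ≡ s + p - p
    isolate = solve-∀
    cancel : ∀ p m → p + m - p ≡ m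
    cancel = solve-∀

altPowerSum-recurrence : ∀ M e →
  + 2 * altPowerSum M (suc e) + Σ< (suc e) (λ k → + (suc e C k) * altPowerSum M k) ≡ - (sgn M * (+ M) ^ suc e)
altPowerSum-recurrence M e = solve-for (Σ< (suc e) (λ k → + (suc e C k) * altPowerSum M k)) (begin
  Σ< (suc e) (λ k → + (suc e C k) * altPowerSum M k) + altPowerSum M (suc e)
    ≡⟨ cong (_+_ (Σ< (suc e) (λ k → + (suc e C k) * altPowerSum M k))) (C[n,n]-* (suc e) _) ⟨
  Σ< (suc (suc e)) (λ k → + (suc e C k) * altPowerSum M k)
    ≡⟨ Σ<-binomial M sgn (suc e) ⟨
  Σ< M (λ x → sgn x * (+ suc x) ^ suc e)
    ≡⟨ altPowerSum-shift M e ⟩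
  - (altPowerSum M (suc e) + sgn M * (+ M) ^ suc e) ∎)
  where
  open ≡-Reasoning
  solve-for : ∀ s {p m} → s + p ≡ - (p + m) → + 2 * p + s ≡ - m
  solve-for s {p} {m} e = trans (isolate s p) (trans (cong (λ t → + 2 * p + t - p) e) (cancel p m))
    where
    isolate : ∀ s p → + 2 * p + s ≡ + 2 * p + (s + p) - p
    isolate = solve-∀
    cancel : ∀ p m → + 2 * p + - (p + m) - p ≡ - m
    cancel = solve-∀

L-cong : ∀ {x y : ℕ → ℤ} e → (∀ k → x k ≡ y k) → L x e ≡ L y e
L-cong e x≡y = cong₂ _+_ (cong (+ 2 *_) (x≡y e)) (Σ<-cong e λ k _ → cong (coeff e k *_) (x≡y k))

L-linear : ∀ (x y : ℕ → ℤ) c e → L (λ k → x k + c * y k) e ≡ L x e + c * L y e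
L-linear x y c e = begin
  + 2 * (x e + c * y e) + Σ< e (λ k → coeff e k * (x k + c * y k))
    ≡⟨ cong (_+_ (+ 2 * (x e + c * y e))) (Σ<-cong e λ k _ → distribute (coeff e k) (x k) c (y k)) ⟩
  + 2 * (x e + c * y e) + Σ< e (λ k → coeff e k * x k + c * (coeff e k * y k))
    ≡⟨ cong (_+_ (+ 2 * (x e + c * y e))) (trans (Σ<-distrib-+ e _ _) (cong (_+_ (Σ< e (λ k → coeff e k * x k))) (Σ<-distribˡ-* e c _))) ⟩
  + 2 * (x e + c * y e) + (Σ< e (λ k → coeff e k * x k) + c * Σ< e (λ k → coeff e k * y k))
    ≡⟨ regroup (x e) c (y e) (Σ< e (λ k → coeff e k * x k)) (Σ< e (λ k → coeff e k * y k)) ⟩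
  L x e + c * L y e ∎
  where
  open ≡-Reasoning
  distribute : ∀ a x c y → a * (x + c * y) ≡ a * x + c * (a * y)
  distribute = solve-∀
  regroup : ∀ x c y s t → + 2 * (x + c * y) + (s + c * t) ≡ (+ 2 * x + s) + c * (+ 2 * y + t)
  regroup = solve-∀

-- Umbrally, ∂ is differentiation.
∂ : (ℕ → ℤ) → ℕ → ℤ
∂ x k = + k * x (k ∸ 1)

L-∂ : ∀ x N → L (∂ x) (suc N) ≡ + suc N * L x N
L-∂ x N = begin
  + 2 * ∂ x (suc N) + Σ< (suc N) (λ k → coeff (suc N) k * ∂ x k)
    ≡⟨ cong (_+_ (+ 2 * ∂ x (suc N))) (Σ<-suc N (λ k → coeff (suc N) k * ∂ x k)) ⟩
  + 2 * ∂ x (suc N) + (coeff (suc N) 0 * (+ 0 * x 0) + Σ< N (λ j → coeff (suc N) (suc j) * ∂ x (suc j)))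
    ≡⟨ cong (λ t → + 2 * ∂ x (suc N) + t) (cong₂ _+_ (ℤₚ.*-zeroʳ (coeff (suc N) 0)) (trans (Σ<-cong N λ j _ → absorb j) (Σ<-distribˡ-* N (+ suc N) _))) ⟩
  + 2 * (+ suc N * x N) + (+ 0 + + suc N * Σ< N (λ j → coeff N j * x j))
    ≡⟨ factor (+ suc N) (x N) (Σ< N (λ j → coeff N j * x j)) ⟩
  + suc N * L x N ∎
  where
  open ≡-Reasoning
  factor : ∀ n x s → + 2 * (n * x) + (+ 0 + n * s) ≡ n * (+ 2 * x + s)
  factor = solve-∀
  absorb : ∀ j → coeff (suc N) (suc j) * ∂ x (suc j) ≡ + suc N * (coeff N j * x j)
  absorb j = begin
    + (suc N C suc j) * w * (+ suc j * x j)   ≡⟨ reorder (+ (suc N C suc j)) w (+ suc j) (x j) ⟩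
    (+ suc j * + (suc N C suc j)) * w * x j   ≡⟨ cong (λ c → c * w * x j) (ℤₚ.pos-* (suc j) (suc N C suc j)) ⟨
    + (suc j ℕ.* (suc N C suc j)) * w * x j   ≡⟨ cong (λ c → + c * w * x j) ([k+1]*[n+1]C[k+1]≡[n+1]*nCk N j) ⟩
    + (suc N ℕ.* (N C j)) * w * x j           ≡⟨ cong (λ c → c * w * x j) (ℤₚ.pos-* (suc N) (N C j)) ⟩
    (+ suc N * + (N C j)) * w * x j           ≡⟨ reassociate (+ suc N) (+ (N C j)) w (x j) ⟩
    + suc N * (coeff N j * x j)               ∎
    where
    w = (+ 2) ^ (N ∸ j)
    reorder : ∀ c w s y → c * w * (s * y) ≡ (s * c) * w * y
    reorder = solve-∀
    reassociate : ∀ n c w y → (n * c) * w * y ≡ n * (c * w * y)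
    reassociate = solve-∀

β : ℕ → ℕ → ℤ
β M k = (+ 2) ^ k * altPowerSum M k

L-β : ∀ M e → L (β M) (suc e) ≡ (+ 2) ^ suc e * - (sgn M * (+ M) ^ suc e)
L-β M e = begin
  + 2 * β M n + Σ< n (λ k → coeff n k * β M k)
    ≡⟨ cong (_+_ (+ 2 * β M n)) (trans (Σ<-cong n λ k k<n → common-power k k<n) (Σ<-distribˡ-* n ((+ 2) ^ n) _)) ⟩
  + 2 * ((+ 2) ^ n * altPowerSum M n) + (+ 2) ^ n * Σ< n (λ k → + (n C k) * altPowerSum M k)
    ≡⟨ factor ((+ 2) ^ n) (altPowerSum M n) _ ⟩
  (+ 2) ^ n * (+ 2 * altPowerSum M n + Σ< n (λ k → + (n C k) * altPowerSum M k))
    ≡⟨ cong ((+ 2) ^ n *_) (altPowerSum-recurrence M e) ⟩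
  (+ 2) ^ n * - (sgn M * (+ M) ^ n) ∎
  where
  open ≡-Reasoning
  n = suc e
  factor : ∀ w a s → + 2 * (w * a) + w * s ≡ w * (+ 2 * a + s)
  factor = solve-∀
  common-power : ∀ k → k < n → coeff n k * β M k ≡ (+ 2) ^ n * (+ (n C k) * altPowerSum M k)
  common-power k k<n = begin
    + (n C k) * (+ 2) ^ (n ∸ k) * ((+ 2) ^ k * altPowerSum M k)
      ≡⟨ reorder (+ (n C k)) ((+ 2) ^ (n ∸ k)) ((+ 2) ^ k) (altPowerSum M k) ⟩
    (+ 2) ^ (n ∸ k) * (+ 2) ^ k * (+ (n C k) * altPowerSum M k)
      ≡⟨ cong (_* (+ (n C k) * altPowerSum M k)) (ℤₚ.^-distribˡ-+-* (+ 2) (n ∸ k) k) ⟨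
    (+ 2) ^ (n ∸ k ℕ.+ k) * (+ (n C k) * altPowerSum M k)
      ≡⟨ cong (λ i → (+ 2) ^ i * (+ (n C k) * altPowerSum M k)) (ℕₚ.m∸n+n≡m (ℕₚ.<⇒≤ k<n)) ⟩
    (+ 2) ^ n * (+ (n C k) * altPowerSum M k) ∎
    where
    reorder : ∀ c u v y → c * u * (v * y) ≡ u * v * (c * y)
    reorder = solve-∀

-- Odd moduli

sgn-+ : ∀ m n → sgn (m ℕ.+ n) ≡ sgn m * sgn n
sgn-+ zero    n = sym (ℤₚ.*-identityˡ _)
sgn-+ (suc m) n = trans (cong -_ (sgn-+ m n)) (ℤₚ.neg-distribˡ-* (sgn m) (sgn n))

sgn-*-sgn : ∀ m → sgn m * sgn m ≡ + 1
sgn-*-sgn zero    = refl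
sgn-*-sgn (suc m) = trans (neg-*-neg (sgn m)) (sgn-*-sgn m)
  where
  neg-*-neg : ∀ s → - s * - s ≡ s * s
  neg-*-neg = solve-∀

sgn-even : ∀ q → sgn (q ℕ.+ q) ≡ + 1
sgn-even q = trans (sgn-+ q q) (sgn-*-sgn q)

neg-^ : ∀ e z → (- z) ^ e ≡ sgn e * z ^ e
neg-^ zero    z = refl
neg-^ (suc e) z = trans (cong (- z *_) (neg-^ e z)) (regroup z (sgn e) (z ^ e))
  where
  regroup : ∀ z s w → - z * (s * w) ≡ - s * (z * w)
  regroup = solve-∀

pos-suc-∸ : ∀ {M x} → x < M → + suc (M ∸ suc x) ≡ + M - + x
pos-suc-∸ {M} {x} x<M = begin
  + suc (M ∸ suc x) ≡⟨ cong +_ (ℕₚ.+-∸-assoc 1 x<M) ⟨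
  + (M ∸ x)         ≡⟨ ℤₚ.⊖-≥ (ℕₚ.<⇒≤ x<M) ⟨
  M ℤ.⊖ x           ≡⟨ ℤₚ.m-n≡m⊖n M x ⟨
  + M - + x         ∎
  where open ≡-Reasoning

Σ<-reflect : ∀ M (w : ℕ → ℤ) e →
  Σ< M (λ x → w x * (+ suc x) ^ e) ≡ Σ< M (λ x → w (M ∸ suc x) * (+ M - + x) ^ e)
Σ<-reflect M w e = trans (Σ<-reverse M _) (Σ<-cong M λ x x<M → cong (λ y → w (M ∸ suc x) * y ^ e) (pos-suc-∸ x<M))

module OddModulus (q : ℕ) where

  M : ℕ
  M = suc (q ℕ.+ q)

  M² : ℤ
  M² = + M * + M

  M-odd : + M ≡ + 2 * + q + + 1
  M-odd = shape (+ q)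
    where
    shape : ∀ x → + 1 + (x + x) ≡ + 2 * x + + 1
    shape = solve-∀

  M²-odd : M² ≡ + 2 * (+ 2 * (+ q * + q) + + 2 * + q) + + 1
  M²-odd = shape (+ q)
    where
    shape : ∀ x → (+ 1 + (x + x)) * (+ 1 + (x + x)) ≡ + 2 * (+ 2 * (x * x) + + 2 * x) + + 1
    shape = solve-∀

  sgn-reflect : ∀ x → x < M → sgn (M ∸ suc x) ≡ sgn x
  sgn-reflect x (s≤s x≤2q) = begin
    sgn (q ℕ.+ q ∸ x)                        ≡⟨ ℤₚ.*-identityʳ _ ⟨
    sgn (q ℕ.+ q ∸ x) * + 1                  ≡⟨ cong (sgn (q ℕ.+ q ∸ x) *_) (sgn-*-sgn x) ⟨
    sgn (q ℕ.+ q ∸ x) * (sgn x * sgn x)      ≡⟨ ℤₚ.*-assoc (sgn (q ℕ.+ q ∸ x)) (sgn x) (sgn x) ⟨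
    sgn (q ℕ.+ q ∸ x) * sgn x * sgn x        ≡⟨ cong (_* sgn x) (sgn-+ (q ℕ.+ q ∸ x) x) ⟨
    sgn (q ℕ.+ q ∸ x ℕ.+ x) * sgn x          ≡⟨ cong (λ n → sgn n * sgn x) (ℕₚ.m∸n+n≡m x≤2q) ⟩
    sgn (q ℕ.+ q) * sgn x                    ≡⟨ cong (_* sgn x) (sgn-even q) ⟩
    + 1 * sgn x                              ≡⟨ ℤₚ.*-identityˡ _ ⟩
    sgn x                                    ∎
    where open ≡-Reasoning

  altPowerSum-0 : altPowerSum M 0 ≡ + 1
  altPowerSum-0 = trans (cong (_+ sgn (q ℕ.+ q) * + 1) (pairs q)) (cong (λ s → + 0 + s * + 1) (sgn-even q))
    where
    pairs : ∀ q → Σ< (q ℕ.+ q) (λ x → sgn x * + 1) ≡ + 0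
    pairs zero    = refl
    pairs (suc q) rewrite ℕₚ.+-suc q q | pairs q = cancel (sgn (q ℕ.+ q))
      where
      cancel : ∀ s → + 0 + s * + 1 + - s * + 1 ≡ + 0
      cancel = solve-∀

  altPowerSum-reflect : ∀ r → let e = suc r ℕ.+ suc r in
    - (altPowerSum M e + sgn M * (+ M) ^ e) ≡ altPowerSum M e ⟨mod + M ⟩
  altPowerSum-reflect r = begin
    - (altPowerSum M e + sgn M * (+ M) ^ e)         ≡⟨ altPowerSum-shift M (r ℕ.+ suc r) ⟨
    Σ< M (λ x → sgn x * (+ suc x) ^ e)             ≡⟨ Σ<-reflect M sgn e ⟩
    Σ< M (λ x → sgn (M ∸ suc x) * (+ M - + x) ^ e) ≈⟨ Σ<-cong-≡mod M term ⟩
    altPowerSum M e                                ∎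
    where
    open ≡mod-Reasoning (+ M)
    e = suc r ℕ.+ suc r
    term : ∀ x → x < M → sgn (M ∸ suc x) * (+ M - + x) ^ e ≡ sgn x * (+ x) ^ e ⟨mod + M ⟩
    term x x<M = begin
      sgn (M ∸ suc x) * (+ M - + x) ^ e ≡⟨ cong (_* (+ M - + x) ^ e) (sgn-reflect x x<M) ⟩
      sgn x * (+ M - + x) ^ e           ≈⟨ *-congˡ-≡mod (sgn x) (^-cong-≡mod e (≡+multiple⇒≡mod {y = - + x} (+ 1) (shift (+ M) (+ x)))) ⟩
      sgn x * (- + x) ^ e               ≡⟨ cong (sgn x *_) (trans (neg-^ e (+ x)) (cong (_* (+ x) ^ e) (sgn-even (suc r)))) ⟩
      sgn x * (+ 1 * (+ x) ^ e)         ≡⟨ cong (sgn x *_) (ℤₚ.*-identityˡ _) ⟩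
      sgn x * (+ x) ^ e                 ∎
      where
      shift : ∀ m x → m - x ≡ - x + m * + 1
      shift = solve-∀

  altPowerSum-even : ∀ r → altPowerSum M (suc r ℕ.+ suc r) ≡ + 0 ⟨mod + M ⟩
  altPowerSum-even r = ∣⇒≡0mod (odd∣2*⇒∣ (+ q) M-odd (≡0mod⇒∣ (begin
    + 2 * A                              ≡⟨ double A ⟩
    A + A                                ≈⟨ +-cong-≡mod (≡⇒≡mod {A} refl) (≡mod-sym (altPowerSum-reflect r)) ⟩
    A + - (A + sgn M * (+ M) ^ e)        ≈⟨ ≡+multiple⇒≡mod (- sgn M * (+ M) ^ e′) (cancel A (sgn M) (+ M) ((+ M) ^ e′)) ⟩
    + 0                                  ∎)))
    where
    open ≡mod-Reasoning (+ M)
    e′ = r ℕ.+ suc r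
    e  = suc e′
    A  = altPowerSum M e
    double : ∀ a → + 2 * a ≡ a + a
    double = solve-∀
    cancel : ∀ a s m w → a + - (a + s * (m * w)) ≡ + 0 + m * (- s * w)
    cancel = solve-∀

  δ : ℕ → ℤ
  δ k = β M k - (α k + + M * ∂ α k)

  L-δ : ∀ N → L δ (suc N) ≡ (+ 2) ^ suc N * (+ M) ^ suc N - + M * (+ suc N * L α N)
  L-δ N = begin
    L δ (suc N)
      ≡⟨ L-cong (suc N) (λ k → subtract (β M k) (α k + + M * ∂ α k)) ⟩
    L (λ k → β M k + -1ℤ * (α k + + M * ∂ α k)) (suc N)
      ≡⟨ L-linear (β M) (λ k → α k + + M * ∂ α k) -1ℤ (suc N) ⟩
    L (β M) (suc N) + -1ℤ * L (λ k → α k + + M * ∂ α k) (suc N)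
      ≡⟨ cong (λ t → L (β M) (suc N) + -1ℤ * t) (L-linear α (∂ α) (+ M) (suc N)) ⟩
    L (β M) (suc N) + -1ℤ * (L α (suc N) + + M * L (∂ α) (suc N))
      ≡⟨ cong₂ (λ s t → s + -1ℤ * t) (L-β M N) (cong₂ (λ a b → a + + M * b) (L-α N) (L-∂ α N)) ⟩
    (+ 2) ^ suc N * - (sgn M * (+ M) ^ suc N) + -1ℤ * (+ 0 + + M * (+ suc N * L α N))
      ≡⟨ cong (λ s → (+ 2) ^ suc N * - (s * (+ M) ^ suc N) + -1ℤ * (+ 0 + + M * (+ suc N * L α N))) (cong -_ (sgn-even q)) ⟩
    (+ 2) ^ suc N * - (- + 1 * (+ M) ^ suc N) + -1ℤ * (+ 0 + + M * (+ suc N * L α N))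
      ≡⟨ simplify ((+ 2) ^ suc N) ((+ M) ^ suc N) (+ M * (+ suc N * L α N)) ⟩
    (+ 2) ^ suc N * (+ M) ^ suc N - + M * (+ suc N * L α N) ∎
    where
    open ≡-Reasoning
    subtract : ∀ a b → a - b ≡ a + - + 1 * b
    subtract = solve-∀
    simplify : ∀ w p s → w * - (- + 1 * p) + - + 1 * (+ 0 + s) ≡ w * p - s
    simplify = solve-∀

  -- For N = 0 the two terms of L-δ cancel; for N > 0 the second vanishes and the first contains M².
  L-δ≡0 : ∀ N → L δ (suc N) ≡ + 0 ⟨mod M² ⟩
  L-δ≡0 zero    = ≡⇒≡mod (trans (L-δ 0) (cancel (+ M)))
    where
    cancel : ∀ m → + 2 * + 1 * (m * + 1) - m * (+ 1 * (+ 2 * + 1 + + 0)) ≡ + 0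
    cancel = solve-∀
  L-δ≡0 (suc N) = ≡+multiple⇒≡mod ((+ 2) ^ suc (suc N) * (+ M) ^ N) (begin
    L δ (suc (suc N))
      ≡⟨ L-δ (suc N) ⟩
    (+ 2) ^ suc (suc N) * (+ M) ^ suc (suc N) - + M * (+ suc (suc N) * L α (suc N))
      ≡⟨ cong (λ t → (+ 2) ^ suc (suc N) * (+ M) ^ suc (suc N) - + M * (+ suc (suc N) * t)) (L-α N) ⟩
    (+ 2) ^ suc (suc N) * (+ M) ^ suc (suc N) - + M * (+ suc (suc N) * + 0)
      ≡⟨ factor ((+ 2) ^ suc (suc N)) (+ M) ((+ M) ^ N) (+ suc (suc N)) ⟩
    + 0 + M² * ((+ 2) ^ suc (suc N) * (+ M) ^ N) ∎)
    where
    open ≡-Reasoning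
    factor : ∀ w m p n → w * (m * (m * p)) - m * (n * + 0) ≡ + 0 + m * m * (w * p)
    factor = solve-∀

  δ-step : ∀ e → (∀ {j} → j < e → M² ∣ δ j) → M² ∣ δ e
  δ-step zero    _ = ≡0mod⇒∣ (≡⇒≡mod (trans (cong (λ a → + 1 * a - (α 0 + + M * ∂ α 0)) altPowerSum-0) (vanish (+ M))))
    where
    vanish : ∀ m → + 1 * + 1 - (+ 1 + m * + 0) ≡ + 0
    vanish = solve-∀
  δ-step (suc N) M²∣δ = odd∣2*⇒∣ (+ 2 * (+ q * + q) + + 2 * + q) M²-odd (≡0mod⇒∣ (begin
    + 2 * δ (suc N)                      ≡⟨ isolate (δ (suc N)) (Σ< (suc N) (λ k → coeff (suc N) k * δ k)) ⟩
    L δ (suc N) - Σ< (suc N) (λ k → coeff (suc N) k * δ k)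
      ≈⟨ +-cong-≡mod (L-δ≡0 N) (neg-cong-≡mod (∣⇒≡0mod (∣-Σ< (suc N) λ k k<N → ℤ∣.∣n⇒∣m*n (coeff (suc N) k) (M²∣δ k<N)))) ⟩
    + 0 - + 0                            ≡⟨⟩
    + 0                                  ∎))
    where
    open ≡mod-Reasoning M²
    isolate : ∀ d s → + 2 * d ≡ (+ 2 * d + s) - s
    isolate = solve-∀

  M²∣δ : ∀ e → M² ∣ δ e
  M²∣δ = <-rec _ δ-step

  β≡α+M∂α : ∀ n → β M n ≡ α n + + M * ∂ α n ⟨mod M² ⟩
  β≡α+M∂α n = mod (M²∣δ n)

  M∣M² : + M ∣ M²
  M∣M² = ℤ∣.∣m⇒∣m*n (+ M) ℤ∣.∣-refl

  α-even : ∀ r → α (suc r ℕ.+ suc r) ≡ + 0 ⟨mod + M ⟩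
  α-even r = begin
    α e                          ≈⟨ ≡mod-sym (≡+multiple⇒≡mod (∂ α e) refl) ⟩
    α e + + M * ∂ α e            ≈⟨ ≡mod-sym (≡mod-weaken M∣M² (β≡α+M∂α e)) ⟩
    (+ 2) ^ e * altPowerSum M e  ≈⟨ *-congˡ-≡mod ((+ 2) ^ e) (altPowerSum-even r) ⟩
    (+ 2) ^ e * + 0              ≡⟨ ℤₚ.*-zeroʳ ((+ 2) ^ e) ⟩
    + 0                          ∎
    where
    open ≡mod-Reasoning (+ M)
    e = suc r ℕ.+ suc r

  β-odd : ∀ r → β M (suc (suc r ℕ.+ suc r)) ≡ α (suc (suc r ℕ.+ suc r)) ⟨mod M² ⟩
  β-odd r = begin
    β M n                       ≈⟨ β≡α+M∂α n ⟩
    α n + + M * (+ n * α e)     ≡⟨ cong (λ a → α n + + M * (+ n * a)) α-e≡tM ⟩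
    α n + + M * (+ n * (t * + M)) ≈⟨ ≡+multiple⇒≡mod (+ n * t) (regroup (α n) (+ M) (+ n) t) ⟩
    α n                         ∎
    where
    open ≡mod-Reasoning M²
    e = suc r ℕ.+ suc r
    n = suc e
    M∣αₑ : + M ∣ α e
    M∣αₑ = ≡0mod⇒∣ (α-even r)
    t = ℤ∣._∣_.quotient M∣αₑ
    α-e≡tM : α e ≡ t * + M
    α-e≡tM = ℤ∣._∣_.equality M∣αₑ
    regroup : ∀ a m n t → a + m * (n * (t * m)) ≡ a + m * m * (n * t)
    regroup = solve-∀

-- Prime moduli

prime∣m*x⇒∣x : ∀ {p} m x → Prime p → 0 < m → m < p → + p ∣ + m * x → + p ∣ x
prime∣m*x⇒∣x {p} m x p-prime 0<m m<p p∣mx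
  with euclidsLemma m ℤ.∣ x ∣ p-prime (subst (p ℕ∣.∣_) (ℤₚ.abs-* (+ m) x) (ℤ∣.∣⇒∣ᵤ p∣mx))
... | inj₂ p∣x = ℤ∣.∣ᵤ⇒∣ p∣x
... | inj₁ p∣m = ⊥-elim (ℕₚ.<⇒≱ m<p (ℕ∣.∣⇒≤ {{ℕ.>-nonZero 0<m}} p∣m))

-- Solving the recurrence of powerSum-recurrence for its last term, whose coefficient j + 1 is a unit mod p.
powerSum-divisible : ∀ {p} → Prime p → ∀ j → suc j < p → + p ∣ powerSum p j
powerSum-divisible {p} p-prime = <-rec _ step
  where
  step : ∀ j → (∀ {k} → k < j → suc k < p → + p ∣ powerSum p k) → suc j < p → + p ∣ powerSum p j
  step j ih j+1<p = prime∣m*x⇒∣x (suc j) (powerSum p j) p-prime (s≤s z≤n) j+1<p (≡0mod⇒∣ (begin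
    + suc j * powerSum p j
      ≡⟨ cong (λ c → + c * powerSum p j) ([n+1]Cn≡n+1 j) ⟨
    + (suc j C j) * powerSum p j
      ≡⟨ isolate (powerSum-recurrence p j) ⟩
    (+ p) ^ suc j - Σ< j (λ k → + (suc j C k) * powerSum p k)
      ≈⟨ +-cong-≡mod (∣⇒≡0mod (ℤ∣.∣m⇒∣m*n ((+ p) ^ j) ℤ∣.∣-refl))
                     (neg-cong-≡mod (∣⇒≡0mod (∣-Σ< j λ k k<j → ℤ∣.∣n⇒∣m*n (+ (suc j C k)) (ih k<j (ℕₚ.<-trans (s≤s k<j) j+1<p))))) ⟩
    + 0 - + 0 ∎))
    where
    open ≡mod-Reasoning (+ p)
    isolate : ∀ {s t r} → s + t ≡ r → t ≡ r - s
    isolate {s} {t} {r} refl = solve t s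
      where
      solve : ∀ t s → t ≡ s + t - s
      solve = solve-∀

binomial-mod-square : ∀ e (m y : ℤ) → (m + y) ^ suc e ≡ y ^ suc e + + suc e * m * y ^ e ⟨mod m * m ⟩
binomial-mod-square zero    m y = ≡⇒≡mod (linear m y)
  where
  linear : ∀ m y → (m + y) * + 1 ≡ y * + 1 + + 1 * m * + 1
  linear = solve-∀
binomial-mod-square (suc e) m y = begin
  (m + y) * (m + y) ^ suc e                            ≈⟨ *-congˡ-≡mod (m + y) (binomial-mod-square e m y) ⟩
  (m + y) * (y ^ suc e + + suc e * m * y ^ e)          ≈⟨ ≡+multiple⇒≡mod (+ suc e * y ^ e) (expand m y (y ^ e) (+ suc e)) ⟩
  y ^ suc (suc e) + + suc (suc e) * m * y ^ suc e      ∎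
  where
  open ≡mod-Reasoning (m * m)
  expand : ∀ m y w n → (m + y) * (y * w + n * m * w) ≡ y * (y * w) + (+ 1 + n) * m * (y * w) + m * m * (n * w)
  expand = solve-∀

sgn≡parity : ∀ x → sgn x ≡ (if x % 2 ≡ᵇ 1 then - + 1 else + 1)
sgn≡parity zero          = refl
sgn≡parity (suc zero)    = refl
sgn≡parity (suc (suc x)) = begin
  - - sgn x                                   ≡⟨ ℤₚ.neg-involutive (sgn x) ⟩
  sgn x                                       ≡⟨ sgn≡parity x ⟩
  (if x % 2 ≡ᵇ 1 then - + 1 else + 1)       ≡⟨ cong (λ r → if r ≡ᵇ 1 then - + 1 else + 1) x+2%2≡x%2 ⟨
  (if suc (suc x) % 2 ≡ᵇ 1 then - + 1 else + 1) ∎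
  where
  open ≡-Reasoning
  x+2%2≡x%2 : suc (suc x) % 2 ≡ x % 2
  x+2%2≡x%2 = trans (cong (_% 2) (ℕₚ.+-comm 2 x)) (ℕDM.[m+n]%n≡m%n x 2)

twice-odd-part : ∀ n x → + 2 * (if x % 2 ≡ᵇ 1 then + (x ℕ.^ n) else + 0) ≡ (+ x) ^ n - sgn x * (+ x) ^ n
twice-odd-part n x rewrite sgn≡parity x | pos-^ x n with x % 2 ≡ᵇ 1
... | true  = odd ((+ x) ^ n)
  where
  odd : ∀ a → + 2 * a ≡ a - - + 1 * a
  odd = solve-∀
... | false = even ((+ x) ^ n)
  where
  even : ∀ a → + 2 * + 0 ≡ a - + 1 * a
  even = solve-∀

module OddPrime (q : ℕ) where
  open OddModulus q

  powerSum-reflect : ∀ r → let e = suc r ℕ.+ suc r ; n = suc e in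
    powerSum M n + (+ M) ^ n ≡ - powerSum M n + + n * + M * powerSum M e ⟨mod M² ⟩
  powerSum-reflect r = begin
    powerSum M n + (+ M) ^ n                         ≡⟨ powerSum-shift M e ⟨
    Σ< M (λ x → (+ suc x) ^ n)                       ≡⟨ Σ<-cong M (λ x _ → ℤₚ.*-identityˡ _) ⟨
    Σ< M (λ x → + 1 * (+ suc x) ^ n)                 ≡⟨ Σ<-reflect M (λ _ → + 1) n ⟩
    Σ< M (λ x → + 1 * (+ M - + x) ^ n)               ≈⟨ Σ<-cong-≡mod M (λ x _ → term x) ⟩
    Σ< M (λ x → - (+ x) ^ n + + n * + M * (+ x) ^ e) ≡⟨ Σ<-distrib-+ M _ _ ⟩
    Σ< M (λ x → - (+ x) ^ n) + Σ< M (λ x → + n * + M * (+ x) ^ e)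
      ≡⟨ cong₂ _+_ (Σ<-neg M (λ x → (+ x) ^ n)) (Σ<-distribˡ-* M (+ n * + M) (λ x → (+ x) ^ e)) ⟩
    - powerSum M n + + n * + M * powerSum M e       ∎
    where
    open ≡mod-Reasoning M²
    e = suc r ℕ.+ suc r
    n = suc e
    term : ∀ x → + 1 * (+ M - + x) ^ n ≡ - (+ x) ^ n + + n * + M * (+ x) ^ e ⟨mod M² ⟩
    term x = begin
      + 1 * (+ M - + x) ^ n                          ≡⟨ ℤₚ.*-identityˡ _ ⟩
      (+ M + - + x) ^ n                              ≈⟨ binomial-mod-square e (+ M) (- + x) ⟩
      (- + x) ^ n + + n * + M * (- + x) ^ e          ≡⟨ cong₂ (λ a b → a + + n * + M * b) (neg-^ n (+ x)) (neg-^ e (+ x)) ⟩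
      sgn n * (+ x) ^ n + + n * + M * (sgn e * (+ x) ^ e)
        ≡⟨ cong (λ s → - s * (+ x) ^ n + + n * + M * (s * (+ x) ^ e)) (sgn-even (suc r)) ⟩
      - + 1 * (+ x) ^ n + + n * + M * (+ 1 * (+ x) ^ e)
        ≡⟨ unit ((+ x) ^ n) ((+ x) ^ e) (+ n * + M) ⟩
      - (+ x) ^ n + + n * + M * (+ x) ^ e            ∎
      where
      unit : ∀ a b c → - + 1 * a + c * (+ 1 * b) ≡ - a + c * b
      unit = solve-∀

  powerSum-odd : Prime M → ∀ r → suc (suc (suc r ℕ.+ suc r)) < M → powerSum M (suc (suc r ℕ.+ suc r)) ≡ + 0 ⟨mod M² ⟩
  powerSum-odd M-prime r n+1<M = ∣⇒≡0mod (odd∣2*⇒∣ (+ 2 * (+ q * + q) + + 2 * + q) M²-odd (≡0mod⇒∣ (begin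
    + 2 * Sₙ                                             ≡⟨ split Sₙ ((+ M) ^ n) ⟩
    (Sₙ + (+ M) ^ n) + (Sₙ - (+ M) ^ n)                  ≈⟨ +-cong-≡mod (powerSum-reflect r) (≡⇒≡mod refl) ⟩
    (- Sₙ + + n * + M * powerSum M e) + (Sₙ - (+ M) ^ n) ≡⟨ cong (λ s → (- Sₙ + + n * + M * s) + (Sₙ - (+ M) ^ n)) Sₑ≡tM ⟩
    (- Sₙ + + n * + M * (t * + M)) + (Sₙ - (+ M) ^ n)
      ≈⟨ ≡+multiple⇒≡mod (+ n * t - (+ M) ^ (r ℕ.+ suc r)) (collect Sₙ (+ n) t (+ M) ((+ M) ^ (r ℕ.+ suc r))) ⟩
    + 0                                                  ∎)))
    where
    open ≡mod-Reasoning M²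
    e = suc r ℕ.+ suc r
    n = suc e
    Sₙ = powerSum M n
    M∣Sₑ : + M ∣ powerSum M e
    M∣Sₑ = powerSum-divisible M-prime e (ℕₚ.<-trans (ℕₚ.n<1+n n) n+1<M)
    t = ℤ∣._∣_.quotient M∣Sₑ
    Sₑ≡tM : powerSum M e ≡ t * + M
    Sₑ≡tM = ℤ∣._∣_.equality M∣Sₑ
    split : ∀ s w → + 2 * s ≡ (s + w) + (s - w)
    split = solve-∀
    collect : ∀ s n t m w → (- s + n * m * (t * m)) + (s - m * (m * w)) ≡ + 0 + m * m * (n * t - w)
    collect = solve-∀

  oddPowerSum : ℕ → ℤ
  oddPowerSum n = Σℤ M (λ x → if x % 2 ≡ᵇ 1 then + (x ℕ.^ n) else + 0)

  twice-oddPowerSum : ∀ n → + 2 * oddPowerSum n ≡ powerSum M n - altPowerSum M n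
  twice-oddPowerSum n = begin
    + 2 * oddPowerSum n                                     ≡⟨ cong (+ 2 *_) (Σℤ≡Σ< M _) ⟩
    + 2 * Σ< M (λ x → if x % 2 ≡ᵇ 1 then + (x ℕ.^ n) else + 0) ≡⟨ Σ<-distribˡ-* M (+ 2) _ ⟨
    Σ< M (λ x → + 2 * (if x % 2 ≡ᵇ 1 then + (x ℕ.^ n) else + 0)) ≡⟨ Σ<-cong M (λ x _ → twice-odd-part n x) ⟩
    Σ< M (λ x → (+ x) ^ n - sgn x * (+ x) ^ n)               ≡⟨ Σ<-distrib-+ M _ _ ⟩
    powerSum M n + Σ< M (λ x → - (sgn x * (+ x) ^ n))        ≡⟨ cong (_+_ (powerSum M n)) (Σ<-neg M _) ⟩
    powerSum M n - altPowerSum M n                          ∎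
    where open ≡-Reasoning

  oddPowerSum-congruence : Prime M → ∀ r → let n = suc (suc r ℕ.+ suc r) in suc n < M →
    ∀ u → u * (+ 2) ^ suc n ≡ + 1 ⟨mod M² ⟩ →
    oddPowerSum n ≡ u * Σℤ n (λ m → sgn m * + E n m) ⟨mod M² ⟩
  oddPowerSum-congruence M-prime r n+1<M u u-inverse = begin
    oddPowerSum n                                        ≡⟨ ℤₚ.*-identityˡ _ ⟨
    + 1 * oddPowerSum n                                  ≈⟨ *-cong-≡mod (≡mod-sym u-inverse) (≡⇒≡mod refl) ⟩
    u * (+ 2) ^ suc n * oddPowerSum n                    ≡⟨ regroup u ((+ 2) ^ n) (oddPowerSum n) ⟩
    u * ((+ 2) ^ n * (+ 2 * oddPowerSum n))              ≡⟨ cong (λ s → u * ((+ 2) ^ n * s)) (twice-oddPowerSum n) ⟩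
    u * ((+ 2) ^ n * (powerSum M n - altPowerSum M n))   ≡⟨ cong (u *_) (distrib ((+ 2) ^ n) (powerSum M n) (altPowerSum M n)) ⟩
    u * ((+ 2) ^ n * powerSum M n - β M n)
      ≈⟨ *-congˡ-≡mod u (+-cong-≡mod (*-congˡ-≡mod ((+ 2) ^ n) (powerSum-odd M-prime r n+1<M)) (neg-cong-≡mod (β-odd r))) ⟩
    u * ((+ 2) ^ n * + 0 - α n)                          ≡⟨ cong (u *_) (vanish ((+ 2) ^ n) (α n)) ⟩
    u * - α n                                            ≡⟨ cong (u *_) (alternating-Eulerian≡-α (suc r ℕ.+ suc r)) ⟨
    u * Σℤ n (λ m → sgn m * + E n m)                     ∎
    where
    open ≡mod-Reasoning M²
    n = suc (suc r ℕ.+ suc r)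
    regroup : ∀ u w o → u * (+ 2 * w) * o ≡ u * (w * (+ 2 * o))
    regroup = solve-∀
    distrib : ∀ w a b → w * (a - b) ≡ w * a - w * b
    distrib = solve-∀
    vanish : ∀ w a → w * + 0 - a ≡ - a
    vanish = solve-∀

even⊎odd : ∀ x → (∃[ q ] x ≡ q ℕ.+ q) ⊎ (∃[ q ] x ≡ suc (q ℕ.+ q))
even⊎odd zero    = inj₁ (0 , refl)
even⊎odd (suc x) with even⊎odd x
... | inj₁ (q , refl) = inj₂ (q , refl)
... | inj₂ (q , refl) = inj₁ (suc q , cong suc (sym (ℕₚ.+-suc q q)))

even-¬prime : ∀ q → 2 < q ℕ.+ q → ¬ Prime (q ℕ.+ q)
even-¬prime q 2<2q = composite⇒¬prime (composite-≢ 2 {{_}} {{ℕ.>-nonZero (ℕₚ.<-trans (s≤s z≤n) 2<2q)}}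
  (ℕₚ.<⇒≢ 2<2q) (ℕ∣.divides q (double q)))
  where
  double : ∀ q → q ℕ.+ q ≡ q ℕ.* 2
  double = ℕ-solve-∀

[mod]⇒⟨mod⟩ : ∀ {x y m} → x ≡ y [mod m ] → x ≡ y ⟨mod m ⟩
[mod]⇒⟨mod⟩ m∣x-y = mod (ℤ∣.∣ᵤ⇒∣ m∣x-y)

⟨mod⟩⇒[mod] : ∀ {x y m} → x ≡ y ⟨mod m ⟩ → x ≡ y [mod m ]
⟨mod⟩⇒[mod] (mod m∣x-y) = ℤ∣.∣⇒∣ᵤ m∣x-y

proposition3 : (p k : ℕ) → Prime p → 2 < p → 1 < k → 2 ℕ.* k ≤ p ∸ 1 →
    (u : ℤ) → (u * (+ (2 ℕ.^ (2 ℕ.* k)))) ≡ + 1 [mod + (p ℕ.^ 2) ] →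
    Σℤ p (λ x → if x % 2 ≡ᵇ 1 then + (x ℕ.^ (2 ℕ.* k ∸ 1)) else + 0)
      ≡ u * Σℤ (2 ℕ.* k ∸ 1) (λ m → sgn m * + (E (2 ℕ.* k ∸ 1) m)) [mod + (p ℕ.^ 2) ]
proposition3 p zero          _ _ ()
proposition3 p (suc zero)    _ _ (s≤s ())
proposition3 p (suc (suc r)) p-prime 2<p _ 2k≤p-1 u u-inverse with even⊎odd p
... | inj₁ (q , refl) = ⊥-elim (even-¬prime q 2<p p-prime)
... | inj₂ (q , refl) = subst (λ e → oddPowerSum e ≡ u * altEulerian e [mod + (M ℕ.^ 2) ]) (cong (_∸ 1) (sym 2k≡n+1))
  (subst (λ m → oddPowerSum n ≡ u * altEulerian n [mod m ]) (sym M^2≡M²)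
    (⟨mod⟩⇒[mod] (oddPowerSum-congruence p-prime r (s≤s (subst (_≤ q ℕ.+ q) 2k≡n+1 2k≤p-1)) u u-inverse′)))
  where
  open OddModulus q
  open OddPrime q
  n = suc (suc r ℕ.+ suc r)
  altEulerian : ℕ → ℤ
  altEulerian e = Σℤ e (λ m → sgn m * + (E e m))
  2k≡n+1 : 2 ℕ.* suc (suc r) ≡ suc n
  2k≡n+1 = double+1 r
    where
    double+1 : ∀ r → 2 ℕ.* suc (suc r) ≡ suc (suc (suc r ℕ.+ suc r))
    double+1 = ℕ-solve-∀
  M^2≡M² : + (M ℕ.^ 2) ≡ M²
  M^2≡M² = trans (pos-^ M 2) (cong (+ M *_) (ℤₚ.*-identityʳ (+ M)))
  u-inverse′ : u * (+ 2) ^ suc n ≡ + 1 ⟨mod M² ⟩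
  u-inverse′ = subst₂ (λ v m → u * v ≡ + 1 ⟨mod m ⟩)
                      (trans (cong (λ e → + (2 ℕ.^ e)) 2k≡n+1) (pos-^ 2 (suc n))) M^2≡M² ([mod]⇒⟨mod⟩ u-inverse)
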